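{- Let $d\ge 8$ and $n\ge 1$. Let $B^0,\dots,B^{n-1}$ be $n$ vertex-disjoint copies of $K_{d-2}$, the vertices of $B^i$ being labelled $a^i_1,\dots,a^i_{d-2}$, and connect consecutive bays by making $a^i_j$ adjacent to $a^{i-1}_{d-1-j}$ for all $0\le i\le n-1$ and $1\le j\le \lceil (d-2)/2\rceil$, superscripts taken mod $n$. Let $P_d$ be the graph obtained from $K_{d+1}$ by deleting the edges of three pairwise vertex-disjoint paths of length 2 and then deleting a maximum matching on the $d-8$ vertices not on these paths (so exactly three vertices of $P_d$ have degree $d-2$). Let $G^n_d$ be obtained by adding pairwise vertex-disjoint copies of $P_d$, where for each copy one edge is added from each of its three vertices of degree $d-2$ to a vertex of a single bay $B^i$ (the same bay for all three edges), there are no edges between distinct copies, and enough copies are added so that every vertex of every $B^i$ has degree at least $d-1$. Then $G^n_d$ has minimum degree $d-1$ and has no immersion of $K_d$.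
   Context: All graphs are simple. A graph $H$ is immersed in a graph $G$ if there is an injection $\phi:V(H)\to V(G)$ and an assignment to each edge $uv\in E(H)$ of a path in $G$ between $\phi(u)$ and $\phi(v)$ with paths of distinct edges pairwise edge-disjoint. -}

module Defs where

open import Data.Nat using (ℕ; zero; suc; _+_; _*_; _∸_; _≤_; _<_; ⌈_/2⌉)
open import Data.Fin using (Fin; toℕ; splitAt; remQuot) renaming (_<_ to _<ᶠ_)
open import Data.Product using (Σ; ∃; _×_; _,_)
open import Data.Sum using (_⊎_; inj₁; inj₂)
open import Data.Empty using (⊥)
open import Data.Unit using (⊤)
open import Data.List using (List; []; _∷_)
open import Data.List.Relation.Unary.Unique.Propositional using (Unique)
open import Relation.Nullary using (¬_)
open import Relation.Binary.PropositionalEquality using (_≡_; _≢_)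

record Graph : Set₁ where
  field
    N      : ℕ
    Adj    : Fin N → Fin N → Set
    sym    : ∀ {u v} → Adj u v → Adj v u
    irrefl : ∀ {v} → ¬ Adj v v
open Graph public

DegAtLeast : (G : Graph) → Fin (N G) → ℕ → Set
DegAtLeast G v k =
  Σ (Fin k → Fin (N G)) λ f →
    (∀ i j → f i ≡ f j → i ≡ j) × (∀ i → Adj G v (f i))

HasDegree : (G : Graph) → Fin (N G) → ℕ → Set
HasDegree G v k =
  Σ (Fin k → Fin (N G)) λ f →
    (∀ i j → f i ≡ f j → i ≡ j) × (∀ i → Adj G v (f i))
      × (∀ u → Adj G v u → ∃ λ i → f i ≡ u)

MinDegree : Graph → ℕ → Set
MinDegree G k = (∀ v → DegAtLeast G v k) × (∃ λ v → HasDegree G v k)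

data Walk (G : Graph) : Fin (N G) → Fin (N G) → Set where
  []  : ∀ {v} → Walk G v v
  _∷_ : ∀ {u v w} → Adj G u v → Walk G v w → Walk G u w

vertices : ∀ {G u w} → Walk G u w → List (Fin (N G))
vertices {u = u} []      = u ∷ []
vertices {u = u} (_ ∷ p) = u ∷ vertices p

IsPath : ∀ {G u w} → Walk G u w → Set
IsPath p = Unique (vertices p)

EdgeIn : ∀ {G u w} → Fin (N G) → Fin (N G) → Walk G u w → Set
EdgeIn a b [] = ⊥
EdgeIn {u = u} a b (_∷_ {v = v} _ p) =
  ((a ≡ u × b ≡ v) ⊎ (a ≡ v × b ≡ u)) ⊎ EdgeIn a b p

-- H is immersed in G.  Each edge of H is represented by the pair x < y.
record Immersion (H G : Graph) : Set where
  field
    φ        : Fin (N H) → Fin (N G)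
    φ-inj    : ∀ x y → φ x ≡ φ y → x ≡ y
    path     : ∀ x y → x <ᶠ y → Adj H x y → Walk G (φ x) (φ y)
    isPath   : ∀ x y (x<y : x <ᶠ y) (e : Adj H x y) → IsPath (path x y x<y e)
    disjoint : ∀ x y x' y' (x<y : x <ᶠ y) (x'<y' : x' <ᶠ y')
               (e : Adj H x y) (e' : Adj H x' y') →
               ¬ (x ≡ x' × y ≡ y') → ∀ a b →
               EdgeIn a b (path x y x<y e) → ¬ EdgeIn a b (path x' y' x'<y' e')

K : ℕ → Graph
K d = record { N = d ; Adj = λ x y → x ≢ y ; sym = λ p q → p (Relation.Binary.PropositionalEquality.sym q)
             ; irrefl = λ p → p Relation.Binary.PropositionalEquality.refl }

-- label of the 0-indexed vertex p of a bay: a_{label p}, labels 1..d-2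
label : ∀ {k} → Fin k → ℕ
label p = suc (toℕ p)

PredMod : (n : ℕ) → Fin n → Fin n → Set
PredMod n i' i = (suc (toℕ i') ≡ toℕ i) ⊎ (toℕ i ≡ 0 × suc (toℕ i') ≡ n)

Ring : (d n : ℕ) → Fin n → Fin (d ∸ 2) → Fin n → Fin (d ∸ 2) → Set
Ring d n i p i' q = PredMod n i' i × label p ≤ ⌈ d ∸ 2 /2⌉ × label p + label q ≡ d ∸ 1

-- Canonical labelling of P_d on vertices 0..d of K_{d+1}:
-- the three deleted paths of length 2 are 3t — 3t+1 — 3t+2 (t = 0,1,2),
-- with middle vertex 3t+1; the deleted maximum matching on 9..d is
-- {9+2k, 10+2k}.
DeletedDir : ℕ → ℕ → Set
DeletedDir a b =
  (Σ (Fin 3) λ t → a ≡ 3 * toℕ t + 1 × (b ≡ 3 * toℕ t ⊎ b ≡ 3 * toℕ t + 2))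
  ⊎ (∃ λ k → a ≡ 9 + 2 * k × b ≡ 10 + 2 * k)

Deleted : ℕ → ℕ → Set
Deleted a b = DeletedDir a b ⊎ DeletedDir b a

data Vtx (d n m : ℕ) : Set where
  bayV  : Fin n → Fin (d ∸ 2) → Vtx d n m
  copyV : Fin m → Fin (suc d) → Vtx d n m

Size : ℕ → ℕ → ℕ → ℕ
Size d n m = n * (d ∸ 2) + m * suc d

decode : ∀ d n m → Fin (Size d n m) → Vtx d n m
decode d n m v with splitAt (n * (d ∸ 2)) v
... | inj₁ x with remQuot {n} (d ∸ 2) x
...   | (i , p) = bayV i p
decode d n m v | inj₂ y with remQuot {m} (suc d) y
...   | (c , a) = copyV c a

-- bay c : the bay copy c is attached to; tgt c t : the vertex of that bay
-- joined to the t-th degree-(d-2) vertex (3t+1) of copy c.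
RawAdj : ∀ d n m → (Fin m → Fin n) → (Fin m → Fin 3 → Fin (d ∸ 2)) →
         Vtx d n m → Vtx d n m → Set
RawAdj d n m bay tgt (bayV i p) (bayV i' q) = i ≡ i' ⊎ Ring d n i p i' q
RawAdj d n m bay tgt (copyV c a) (copyV c' b) = c ≡ c' × ¬ Deleted (toℕ a) (toℕ b)
RawAdj d n m bay tgt (copyV c a) (bayV i p) =
  Σ (Fin 3) λ t → toℕ a ≡ 3 * toℕ t + 1 × i ≡ bay c × p ≡ tgt c t
RawAdj d n m bay tgt (bayV i p) (copyV c a) = ⊥

GAdj : ∀ d n m → (Fin m → Fin n) → (Fin m → Fin 3 → Fin (d ∸ 2)) →
       Fin (Size d n m) → Fin (Size d n m) → Set
GAdj d n m bay tgt x y =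
  x ≢ y × (RawAdj d n m bay tgt (decode d n m x) (decode d n m y)
           ⊎ RawAdj d n m bay tgt (decode d n m y) (decode d n m x))

Gnd : ∀ d n m → (Fin m → Fin n) → (Fin m → Fin 3 → Fin (d ∸ 2)) → Graph
Gnd d n m bay tgt = record
  { N = Size d n m
  ; Adj = GAdj d n m bay tgt
  ; sym = λ { (ne , inj₁ r) → (λ e → ne (Relation.Binary.PropositionalEquality.sym e)) , inj₂ r
            ; (ne , inj₂ r) → (λ e → ne (Relation.Binary.PropositionalEquality.sym e)) , inj₁ r }
  ; irrefl = λ { (ne , _) → ne Relation.Binary.PropositionalEquality.refl }
  }

IsBay : ∀ {d n m} → Vtx d n m → Set
IsBay (bayV _ _)  = ⊤
IsBay (copyV _ _) = ⊥

module Submission where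

-- Every vertex of a copy of P_d has at least d-1
-- neighbours: a middle vertex sees its bay vertex and the d-2 copy vertices
-- off its deleted path, any other vertex all copy vertices but itself and at
-- most one deleted partner.  Vertex 0 of a copy has exactly d-1 neighbours.
-- Bay vertices have degree ≥ d-1 by hypothesis, which also forces a copy to
-- exist: without copies a_1 has only d-2 neighbours.
--
-- Two general facts about an immersion of K_d in any graph
-- drive the argument: a branch vertex lying inside a foreign path has
-- degree ≥ d+1 (crowdedBranch), and a vertex set separating M pairs of
-- branch vertices has at least M edges in its cut (cutBound).  Copy
-- vertices have degree ≤ d, so they are never interior branch vertices.
--  * A copy holding some but not all branch vertices separates d-1 pairs
--    by a cut of 3 edges.
--  * A copy holding all d branch vertices leaves out exactly one vertex w;
--    following the paths from a middle vertex to its two deleted partners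
--    shows that they would have to share an edge (through w, or through the
--    single edge joining the bay to w).
--  * If all branch vertices lie in bays, an arc of consecutive bays holding
--    two of them and missing two others separates d pairs, while its cut
--    has at most 2⌈(d-2)/2⌉ ≤ d-1 ring edges; if no such arc exists, d-1
--    branch vertices crowd into one bay of size d-2.

open import Defs using (IsBay; decode; DegAtLeast; Gnd; MinDegree; Immersion; K)
open import Data.Nat using (ℕ; _+_; _≤_; _∸_; suc; s≤s; z≤n)
open import Data.Fin using (Fin; zero)
open import Data.Product using (_×_; _,_)
open import Relation.Nullary using (¬_)

module Encoding where

  open import Defs hiding (sym)
  open import Data.Nat using (suc; _+_; _*_; _∸_)
  open import Data.Fin using (Fin; splitAt; join; combine)
  open import Data.Fin.Properties using (splitAt-join; join-splitAt; remQuot-combine; combine-remQuot)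
  open import Data.Product using (proj₁; proj₂)
  open import Data.Sum using (inj₁; inj₂)
  open import Relation.Binary.PropositionalEquality

  encode : ∀ d n m → Vtx d n m → Fin (Size d n m)
  encode d n m (bayV i p)  = join (n * (d ∸ 2)) (m * suc d) (inj₁ (combine i p))
  encode d n m (copyV c a) = join (n * (d ∸ 2)) (m * suc d) (inj₂ (combine c a))

  decode-encode : ∀ d n m v → decode d n m (encode d n m v) ≡ v
  decode-encode d n m (bayV i p)
    rewrite splitAt-join (n * (d ∸ 2)) (m * suc d) (inj₁ (combine i p)) =
      cong (λ r → bayV (proj₁ r) (proj₂ r)) (remQuot-combine {n} {d ∸ 2} i p)
  decode-encode d n m (copyV c a)
    rewrite splitAt-join (n * (d ∸ 2)) (m * suc d) (inj₂ (combine c a)) =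
      cong (λ r → copyV (proj₁ r) (proj₂ r)) (remQuot-combine {m} {suc d} c a)

  -- splitAt N is inverted by join N, phrased for a known value of the split
  join-of-splitAt : ∀ N M {v : Fin (N + M)} {s} → splitAt N v ≡ s → join N M s ≡ v
  join-of-splitAt N M {v} refl = join-splitAt N M v

  encode-decode : ∀ d n m v → encode d n m (decode d n m v) ≡ v
  encode-decode d n m v with splitAt (n * (d ∸ 2)) v in eq
  ... | inj₁ x = trans (cong (λ z → join (n * (d ∸ 2)) (m * suc d) (inj₁ z)) (combine-remQuot {n} (d ∸ 2) x))
                       (join-of-splitAt (n * (d ∸ 2)) (m * suc d) eq)
  ... | inj₂ y = trans (cong (λ z → join (n * (d ∸ 2)) (m * suc d) (inj₂ z)) (combine-remQuot {m} (suc d) y))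
                       (join-of-splitAt (n * (d ∸ 2)) (m * suc d) eq)

  decode-inj : ∀ d n m {u v} → decode d n m u ≡ decode d n m v → u ≡ v
  decode-inj d n m {u} {v} e =
    trans (sym (encode-decode d n m u)) (trans (cong (encode d n m) e) (encode-decode d n m v))

module Walks where

  open import Defs hiding (sym)
  open import Data.Fin using (Fin)
  open import Data.Fin.Properties using (_≟_)
  open import Data.Product using (∃; ∃₂; _×_; _,_)
  open import Data.Sum using (_⊎_; inj₁; inj₂)
  open import Data.Empty using (⊥-elim)
  open import Data.List using (_∷_)
  open import Data.List.Membership.Propositional using (_∈_)
  open import Data.List.Relation.Unary.Any using (here; there)
  open import Data.List.Relation.Unary.All as All using ()
  open import Data.List.Relation.Unary.AllPairs using (_∷_)
  open import Data.List.Relation.Unary.Unique.Propositional using (Unique)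
  open import Relation.Nullary using (¬_; yes; no; ¬?)
  open import Relation.Unary using (Decidable)
  open import Relation.Binary.PropositionalEquality

  module _ {G : Graph} where
    private
      V = Fin (N G)

    EdgeIn⇒Adj : ∀ {u w} (W : Walk G u w) {a b} → EdgeIn a b W → Adj G a b
    EdgeIn⇒Adj (e ∷ W) (inj₁ (inj₁ (refl , refl))) = e
    EdgeIn⇒Adj (e ∷ W) (inj₁ (inj₂ (refl , refl))) = Graph.sym G e
    EdgeIn⇒Adj (e ∷ W) (inj₂ x) = EdgeIn⇒Adj W x

    EdgeIn-sym : ∀ {u w} (W : Walk G u w) {a b} → EdgeIn a b W → EdgeIn b a W
    EdgeIn-sym (e ∷ W) (inj₁ (inj₁ (p , q))) = inj₁ (inj₂ (q , p))
    EdgeIn-sym (e ∷ W) (inj₁ (inj₂ (p , q))) = inj₁ (inj₁ (q , p))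
    EdgeIn-sym (e ∷ W) (inj₂ x) = inj₂ (EdgeIn-sym W x)

    start∈ : ∀ {v w} (W : Walk G v w) → v ∈ vertices W
    start∈ [] = here refl
    start∈ (_ ∷ _) = here refl

    EdgeIn⇒∈ʳ : ∀ {u w} (W : Walk G u w) {a b} → EdgeIn a b W → b ∈ vertices W
    EdgeIn⇒∈ʳ (e ∷ W) (inj₁ (inj₁ (_ , refl))) = there (start∈ W)
    EdgeIn⇒∈ʳ (e ∷ W) (inj₁ (inj₂ (_ , refl))) = here refl
    EdgeIn⇒∈ʳ (e ∷ W) (inj₂ x) = there (EdgeIn⇒∈ʳ W x)

    EdgeIn⇒∈ˡ : ∀ {u w} (W : Walk G u w) {a b} → EdgeIn a b W → a ∈ vertices W
    EdgeIn⇒∈ˡ W x = EdgeIn⇒∈ʳ W (EdgeIn-sym W x)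

    firstEdge : ∀ {u w} (W : Walk G u w) → u ≢ w → ∃ λ y → EdgeIn u y W
    firstEdge [] ne = ⊥-elim (ne refl)
    firstEdge (_∷_ {v = v} e W) ne = v , inj₁ (inj₁ (refl , refl))

    lastEdge : ∀ {u v w} (e : Adj G u v) (W : Walk G v w) → ∃ λ y → EdgeIn w y (e ∷ W)
    lastEdge {u = u} e [] = u , inj₁ (inj₂ (refl , refl))
    lastEdge e (e' ∷ W) = let (y , p) = lastEdge e' W in y , inj₂ p

    endEdge : ∀ {a b x} (W : Walk G a b) → a ≢ b → (x ≡ a ⊎ x ≡ b) → ∃ λ y → EdgeIn x y W
    endEdge W       ne (inj₁ refl) = firstEdge W ne
    endEdge []      ne (inj₂ refl) = ⊥-elim (ne refl)
    endEdge (e ∷ W) ne (inj₂ refl) = lastEdge e W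

    crossingEdge : {S : V → Set} → Decidable S → ∀ {u w} (W : Walk G u w) → S u → ¬ S w →
                   ∃₂ λ a b → S a × ¬ S b × EdgeIn a b W
    crossingEdge S? [] su nsw = ⊥-elim (nsw su)
    crossingEdge S? (_∷_ {u = u} {v = v} e W) su nsw with S? v
    ... | no nsv = u , v , su , nsv , inj₁ (inj₁ (refl , refl))
    ... | yes sv = let (a , b , sa , nsb , p) = crossingEdge S? W sv nsw in a , b , sa , nsb , inj₂ p

    crossingEdge⁻ : {S : V → Set} → Decidable S → ∀ {u w} (W : Walk G u w) → ¬ S u → S w →
                    ∃₂ λ a b → S a × ¬ S b × EdgeIn a b W
    crossingEdge⁻ {S} S? W nsu sw with crossingEdge (λ x → ¬? (S? x)) W nsu (λ k → k sw)
    ... | a , b , nsa , nnsb , p with S? b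
    ...   | yes sb = b , a , sb , nsa , EdgeIn-sym W p
    ...   | no nsb = ⊥-elim (nnsb nsb)

    head∉tail : ∀ {u v w y} (W : Walk G v w) → Unique (u ∷ vertices W) → y ∈ vertices W → u ≢ y
    head∉tail W (px ∷ _) y∈ = All.lookup px y∈

    interiorEdges : ∀ {u w y} (W : Walk G u w) → IsPath W → y ∈ vertices W → y ≢ u → y ≢ w →
                    ∃₂ λ a b → a ≢ b × EdgeIn y a W × EdgeIn y b W
    interiorEdges [] _ (here refl) nu nw = ⊥-elim (nu refl)
    interiorEdges (e ∷ W) _ (here refl) nu nw = ⊥-elim (nu refl)
    interiorEdges {y = y} (_∷_ {u = u} {v = v} e W) up@(_ ∷ up') (there y∈) nu nw with y ≟ v
    ... | yes refl =
          let (z , p) = firstEdge W nw in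
          u , z , head∉tail W up (EdgeIn⇒∈ʳ W p) , inj₁ (inj₂ (refl , refl)) , inj₂ p
    ... | no nv =
          let (a , b , ne , p , q) = interiorEdges W up' y∈ nv nw in a , b , ne , inj₂ p , inj₂ q

    returnEdge : {S : V → Set} → Decidable S → ∀ {u w a b} (W : Walk G u w) → IsPath W →
                 S u → S w → EdgeIn a b W → S a → ¬ S b →
                 ∃₂ λ o y → ¬ S o × S y × EdgeIn o y W × y ≢ a
    returnEdge S? (_∷_ {u = u} {v = v} e W) up su sw (inj₁ (inj₁ (refl , refl))) sa nsb =
      let (y , o , sy , nso , p) = crossingEdge⁻ S? W nsb sw in
      o , y , nso , sy , inj₂ (EdgeIn-sym W p) ,
        (λ eq → head∉tail W up (EdgeIn⇒∈ˡ W p) (sym eq))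
    returnEdge S? (e ∷ W) up su sw (inj₁ (inj₂ (refl , refl))) sa nsb = ⊥-elim (nsb su)
    returnEdge S? (_∷_ {u = u} {v = v} e W) up@(_ ∷ up') su sw (inj₂ p) sa nsb with S? v
    ... | yes sv = let (o , y , nso , sy , q , ne) = returnEdge S? W up' sv sw p sa nsb in
                   o , y , nso , sy , inj₂ q , ne
    ... | no nsv = v , u , nsv , su , inj₁ (inj₂ (refl , refl)) ,
                   (λ eq → head∉tail W up (EdgeIn⇒∈ˡ W p) eq)

module Pairs where

  open import Data.Nat using (ℕ; suc)
  open import Data.Fin using (Fin; zero; suc; punchIn)
  open import Data.Fin.Properties using (punchIn-injective; punchInᵢ≢i)
  open import Data.Product using (_×_; _,_; proj₁; proj₂)
  open import Data.Empty using (⊥-elim)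
  open import Relation.Nullary using (¬_; yes; no)
  open import Relation.Unary using (Decidable)
  open import Relation.Binary.PropositionalEquality

  record SeparatedPairs {k : ℕ} (T : Fin k → Set) (M : ℕ) : Set where
    field
      pair     : Fin M → Fin k × Fin k
      pair-inj : ∀ r r' → pair r ≡ pair r' → r ≡ r'
      inside   : ∀ r → T (proj₁ (pair r))
      outside  : ∀ r → ¬ T (proj₂ (pair r))

  module _ {d' : ℕ} {T : Fin (suc d') → Set} (T? : Decidable T)
           (i₀ j₀ : Fin (suc d')) (Ti₀ : T i₀) (¬Tj₀ : ¬ T j₀) where

    -- one separated pair (i₀ , j₀) yields d' of them: every r ≠ j₀ is paired
    -- with j₀ if T r, and with i₀ otherwise
    pairWith : Fin d' → Fin (suc d') × Fin (suc d')
    pairWith r with T? (punchIn j₀ r)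
    ... | yes _ = punchIn j₀ r , j₀
    ... | no _  = i₀ , punchIn j₀ r

    pairWith-inside : ∀ r → T (proj₁ (pairWith r))
    pairWith-inside r with T? (punchIn j₀ r)
    ... | yes t = t
    ... | no _  = Ti₀

    pairWith-outside : ∀ r → ¬ T (proj₂ (pairWith r))
    pairWith-outside r with T? (punchIn j₀ r)
    ... | yes _ = ¬Tj₀
    ... | no nt = nt

    pairWith-inj : ∀ r r' → pairWith r ≡ pairWith r' → r ≡ r'
    pairWith-inj r r' e with T? (punchIn j₀ r) | T? (punchIn j₀ r')
    ... | yes _ | yes _ = punchIn-injective j₀ r r' (cong proj₁ e)
    ... | yes _ | no _  = ⊥-elim (punchInᵢ≢i j₀ r' (sym (cong proj₂ e)))
    ... | no _  | yes _ = ⊥-elim (punchInᵢ≢i j₀ r (cong proj₂ e))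
    ... | no _  | no _  = punchIn-injective j₀ r r' (cong proj₂ e)

    separatedPairs₁ : SeparatedPairs T d'
    separatedPairs₁ = record { pair = pairWith ; pair-inj = pairWith-inj
                             ; inside = pairWith-inside ; outside = pairWith-outside }

    module _ (i₁ j₁ : Fin (suc d')) (Ti₁ : T i₁) (¬Tj₁ : ¬ T j₁)
             (i₀≢i₁ : i₀ ≢ i₁) (j₀≢j₁ : j₀ ≢ j₁) where

      pairWith≢ : ∀ r → pairWith r ≢ (i₁ , j₁)
      pairWith≢ r e with T? (punchIn j₀ r)
      ... | yes _ = j₀≢j₁ (cong proj₂ e)
      ... | no _  = i₀≢i₁ (cong proj₁ e)

      pairs₂ : Fin (suc d') → Fin (suc d') × Fin (suc d')
      pairs₂ zero    = i₁ , j₁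
      pairs₂ (suc r) = pairWith r

      pairs₂-inj : ∀ r r' → pairs₂ r ≡ pairs₂ r' → r ≡ r'
      pairs₂-inj zero    zero     e = refl
      pairs₂-inj zero    (suc r') e = ⊥-elim (pairWith≢ r' (sym e))
      pairs₂-inj (suc r) zero     e = ⊥-elim (pairWith≢ r e)
      pairs₂-inj (suc r) (suc r') e = cong suc (pairWith-inj r r' e)

      separatedPairs₂ : SeparatedPairs T (suc d')
      separatedPairs₂ = record
        { pair = pairs₂ ; pair-inj = pairs₂-inj
        ; inside  = λ { zero → Ti₁  ; (suc r) → pairWith-inside r }
        ; outside = λ { zero → ¬Tj₁ ; (suc r) → pairWith-outside r } }

module Immersions where

  open import Defs hiding (sym)
  open Walks
  open Pairs
  open import Data.Nat using (ℕ; zero; suc; _≤_)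
  open import Data.Fin using (Fin; zero; suc; punchIn) renaming (_<_ to _<ᶠ_)
  open import Data.Fin.Properties using (<-cmp; punchIn-injective; punchInᵢ≢i; injective⇒≤) renaming (_≟_ to _≟F_)
  open import Data.List.Membership.Propositional using (_∈_)
  open import Data.Product using (∃; ∃₂; _×_; _,_; proj₁; proj₂)
  open import Data.Sum using (_⊎_; inj₁; inj₂)
  open import Data.Empty using (⊥; ⊥-elim)
  open import Relation.Nullary using (¬_; yes; no)
  open import Relation.Unary using (Decidable)
  open import Relation.Binary.Definitions using (tri<; tri≈; tri>)
  open import Relation.Binary.PropositionalEquality

  -- the edge cut between S and its complement has at most K edges: its edges,
  -- oriented out of S, can be coded injectively by Fin K
  record CutAtMost (G : Graph) (S : Fin (N G) → Set) (K : ℕ) : Set where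
    field
      code     : ∀ a b → S a → ¬ S b → Adj G a b → Fin K
      code-inj : ∀ a b a' b' sa nsb e sa' nsb' e' →
                 code a b sa nsb e ≡ code a' b' sa' nsb' e' → a ≡ a' × b ≡ b'

  module Branching (G : Graph) (d' : ℕ) (I : Immersion (K (suc d')) G) where
    open Immersion I
    private
      V = Fin (N G)
      d = suc d'

    φ≢ : ∀ {k k'} → k ≢ k' → φ k ≢ φ k'
    φ≢ ne e = ne (φ-inj _ _ e)

    -- the path of the immersion joining the branch vertices of k and k'
    -- (the immersion stores it under the ordered pair x < y)
    record Seg (k k' : Fin d) : Set where
      field
        x y   : Fin d
        x<y   : x <ᶠ y
        ne    : x ≢ y
        owner : (x ≡ k × y ≡ k') ⊎ (x ≡ k' × y ≡ k)
    open Seg public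

    W : ∀ {k k'} (s : Seg k k') → Walk G (φ (x s)) (φ (y s))
    W s = path (x s) (y s) (x<y s) (ne s)

    Wpath : ∀ {k k'} (s : Seg k k') → IsPath (W s)
    Wpath s = isPath (x s) (y s) (x<y s) (ne s)

    seg : (k k' : Fin d) → k ≢ k' → Seg k k'
    seg k k' kk with <-cmp k k'
    ... | tri< lt _ _ = record { x = k ; y = k' ; x<y = lt ; ne = kk ; owner = inj₁ (refl , refl) }
    ... | tri≈ _ eq _ = ⊥-elim (kk eq)
    ... | tri> _ _ gt = record { x = k' ; y = k ; x<y = gt ; ne = λ e → kk (sym e) ; owner = inj₂ (refl , refl) }

    SamePair : Fin d → Fin d → Fin d → Fin d → Set
    SamePair k k' l l' = (k ≡ l × k' ≡ l') ⊎ (k ≡ l' × k' ≡ l)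

    segDisj : ∀ {k k' l l' a b} (s : Seg k k') (t : Seg l l') →
              EdgeIn a b (W s) → EdgeIn a b (W t) → SamePair k k' l l'
    segDisj {a = a} {b} s t p q with x s ≟F x t | y s ≟F y t
    ... | yes ex | yes ey = samePair (owner s) (owner t) ex ey
      where
      samePair : ∀ {k k' l l' xs ys xt yt} → (xs ≡ k × ys ≡ k') ⊎ (xs ≡ k' × ys ≡ k) →
                 (xt ≡ l × yt ≡ l') ⊎ (xt ≡ l' × yt ≡ l) → xs ≡ xt → ys ≡ yt → SamePair k k' l l'
      samePair (inj₁ (refl , refl)) (inj₁ (refl , refl)) refl refl = inj₁ (refl , refl)
      samePair (inj₁ (refl , refl)) (inj₂ (refl , refl)) refl refl = inj₂ (refl , refl)
      samePair (inj₂ (refl , refl)) (inj₁ (refl , refl)) refl refl = inj₂ (refl , refl)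
      samePair (inj₂ (refl , refl)) (inj₂ (refl , refl)) refl refl = inj₁ (refl , refl)
    ... | no nx | _ = ⊥-elim (disjoint (x s) (y s) (x t) (y t) (x<y s) (x<y t) (ne s) (ne t)
                        (λ { (e1 , _) → nx e1 }) a b p q)
    ... | yes _ | no ny = ⊥-elim (disjoint (x s) (y s) (x t) (y t) (x<y s) (x<y t) (ne s) (ne t)
                        (λ { (_ , e2) → ny e2 }) a b p q)

    endsOf : ∀ {k k'} (s : Seg k k') → (φ k ≡ φ (x s) ⊎ φ k ≡ φ (y s))
    endsOf s with owner s
    ... | inj₁ (refl , refl) = inj₁ refl
    ... | inj₂ (refl , refl) = inj₂ refl

    edgeAt : ∀ {k k'} (s : Seg k k') → ∃ λ u → EdgeIn (φ k) u (W s)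
    edgeAt s = endEdge (W s) (φ≢ (ne s)) (endsOf s)

    -- a branch vertex φ z lying on two edges of the path of a pair {i , j} not
    -- containing z has degree at least d+1: besides those two edges, each of
    -- the d-1 paths leaving φ z contributes its own first edge
    crowdedBranch : ∀ z {i j a b} (s : Seg i j) → z ≢ i → z ≢ j → a ≢ b →
                    EdgeIn (φ z) a (W s) → EdgeIn (φ z) b (W s) → DegAtLeast G (φ z) (suc d)
    crowdedBranch z {a = a} {b} s zi zj ab pa pb = g , ginj , gadj
      where
      z≢ : (k : Fin d') → z ≢ punchIn z k
      z≢ k e = punchInᵢ≢i z k (sym e)
      sg : (k : Fin d') → Seg z (punchIn z k)
      sg k = seg z (punchIn z k) (z≢ k)
      g : Fin (suc d) → V
      g zero          = a
      g (suc zero)    = b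
      g (suc (suc k)) = proj₁ (edgeAt (sg k))
      gadj : ∀ p → Adj G (φ z) (g p)
      gadj zero          = EdgeIn⇒Adj (W s) pa
      gadj (suc zero)    = EdgeIn⇒Adj (W s) pb
      gadj (suc (suc k)) = EdgeIn⇒Adj (W (sg k)) (proj₂ (edgeAt (sg k)))
      edgeAt≡ : ∀ k {c} → c ≡ g (suc (suc k)) → EdgeIn (φ z) c (W (sg k))
      edgeAt≡ k refl = proj₂ (edgeAt (sg k))
      notOnS : ∀ k {c} → EdgeIn (φ z) c (W s) → c ≡ g (suc (suc k)) → ⊥
      notOnS k p e with segDisj s (sg k) p (edgeAt≡ k e)
      ... | inj₁ (e' , _) = zi (sym e')
      ... | inj₂ (_ , e') = zj (sym e')
      ginj : ∀ p q → g p ≡ g q → p ≡ q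
      ginj zero          zero          e = refl
      ginj zero          (suc zero)    e = ⊥-elim (ab e)
      ginj (suc zero)    zero          e = ⊥-elim (ab (sym e))
      ginj (suc zero)    (suc zero)    e = refl
      ginj zero          (suc (suc k)) e = ⊥-elim (notOnS k pa e)
      ginj (suc zero)    (suc (suc k)) e = ⊥-elim (notOnS k pb e)
      ginj (suc (suc k)) zero          e = ⊥-elim (notOnS k pa (sym e))
      ginj (suc (suc k)) (suc zero)    e = ⊥-elim (notOnS k pb (sym e))
      ginj (suc (suc k)) (suc (suc k')) e with segDisj (sg k) (sg k') (edgeAt≡ k refl) (edgeAt≡ k' e)
      ... | inj₁ (_ , e2) = cong (λ t → suc (suc t)) (punchIn-injective z k k' e2)
      ... | inj₂ (e1 , _) = ⊥-elim (z≢ k' e1)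

    branchOnPath : ∀ z {i j} (s : Seg i j) → z ≢ i → z ≢ j → φ z ∈ vertices (W s) →
                   DegAtLeast G (φ z) (suc d)
    branchOnPath z s zi zj mem =
      let (a , b , ab , pa , pb) = interiorEdges (W s) (Wpath s) mem (proj₁ notEnds) (proj₂ notEnds)
      in crowdedBranch z s zi zj ab pa pb
      where
      notEnds : φ z ≢ φ (x s) × φ z ≢ φ (y s)
      notEnds with owner s
      ... | inj₁ (refl , refl) = φ≢ zi , φ≢ zj
      ... | inj₂ (refl , refl) = φ≢ zj , φ≢ zi

    segCross : {S : V → Set} → Decidable S → ∀ {p q} (s : Seg p q) → S (φ p) → ¬ S (φ q) →
               ∃₂ λ a b → S a × ¬ S b × EdgeIn a b (W s)
    segCross S? s sp nsq with owner s
    ... | inj₁ (refl , refl) = crossingEdge S? (W s) sp nsq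
    ... | inj₂ (refl , refl) = crossingEdge⁻ S? (W s) nsq sp

    cutBound : {S : V → Set} → Decidable S → ∀ {Kc M} → CutAtMost G S Kc →
               SeparatedPairs (λ k → S (φ k)) M → M ≤ Kc
    cutBound {S} S? {Kc} {M} cut P = injective⇒≤ {f = F} Finj
      where
      open CutAtMost cut
      open SeparatedPairs P
      separated : ∀ r → proj₁ (pair r) ≢ proj₂ (pair r)
      separated r e = outside r (subst (λ t → S (φ t)) e (inside r))
      sr : ∀ r → Seg (proj₁ (pair r)) (proj₂ (pair r))
      sr r = seg _ _ (separated r)
      cr : ∀ r → ∃₂ λ a b → S a × ¬ S b × EdgeIn a b (W (sr r))
      cr r = segCross S? (sr r) (inside r) (outside r)
      F : Fin M → Fin Kc
      F r = let (a , b , sa , nsb , e) = cr r in code a b sa nsb (EdgeIn⇒Adj (W (sr r)) e)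
      Finj : ∀ {r r'} → F r ≡ F r' → r ≡ r'
      Finj {r} {r'} eq with cr r | cr r' | code-inj _ _ _ _ _ _ _ _ _ _ eq
      ... | (a , b , _ , _ , e) | (.a , .b , _ , _ , e') | (refl , refl) with segDisj (sr r) (sr r') e e'
      ...   | inj₁ (e1 , e2) = pair-inj r r' (cong₂ _,_ e1 e2)
      ...   | inj₂ (e1 , _) = ⊥-elim (outside r' (subst (λ t → S (φ t)) e1 (inside r)))

module FinFacts where

  open import Data.Nat using (ℕ; zero; suc; _≤_; _≤?_)
  import Data.Nat.Properties as ℕP
  open import Data.Fin using (Fin; zero; suc; punchIn; punchOut; join; splitAt)
  open import Data.Fin.Properties using (punchIn-injective; punchInᵢ≢i; punchOut-injective; punchIn-punchOut; splitAt-join; injective⇒≤; any?; all?; ¬∀⟶∃¬) renaming (_≟_ to _≟F_)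
  open import Data.Product using (Σ; ∃; _×_; _,_; proj₁; proj₂)
  open import Data.Sum using (_⊎_; inj₁; inj₂)
  open import Data.Empty using (⊥-elim)
  open import Relation.Nullary using (¬_; yes; no; ¬?)
  open import Relation.Nullary.Decidable using (_×-dec_)
  open import Relation.Unary using (Decidable)
  open import Relation.Binary.PropositionalEquality

  Inj : ∀ {A B : Set} → (A → B) → Set
  Inj f = ∀ {x y} → f x ≡ f y → x ≡ y

  join-injective : ∀ M N (x y : Fin M ⊎ Fin N) → join M N x ≡ join M N y → x ≡ y
  join-injective M N x y eq = trans (sym (splitAt-join M N x)) (trans (cong (splitAt M) eq) (splitAt-join M N y))

  avoid₂ : ∀ {N} (a x : Fin (suc (suc N))) → x ≢ a →
           Σ (Fin N → Fin (suc (suc N))) λ f → Inj f × (∀ i → f i ≢ a) × (∀ i → f i ≢ x)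
             × (∀ b → b ≢ a → b ≢ x → ∃ λ i → f i ≡ b)
  avoid₂ {N} a x xa = f , finj , fa , fx , fsurj
    where
    ax : a ≢ x
    ax e = xa (sym e)
    x' : Fin (suc N)
    x' = punchOut ax
    f : Fin N → Fin (suc (suc N))
    f i = punchIn a (punchIn x' i)
    finj : Inj f
    finj {i} {j} e = punchIn-injective x' i j (punchIn-injective a _ _ e)
    fa : ∀ i → f i ≢ a
    fa i = punchInᵢ≢i a _
    fx : ∀ i → f i ≢ x
    fx i e = punchInᵢ≢i x' i (punchIn-injective a _ _ (trans e (sym (punchIn-punchOut ax))))
    fsurj : ∀ b → b ≢ a → b ≢ x → ∃ λ i → f i ≡ b
    fsurj b ba bx = punchOut {i = x'} {j = b'} x'b' ,
        trans (cong (punchIn a) (punchIn-punchOut x'b')) (punchIn-punchOut ab)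
      where
      ab : a ≢ b
      ab e = ba (sym e)
      b' : Fin (suc N)
      b' = punchOut ab
      x'b' : x' ≢ b'
      x'b' e = bx (trans (sym (punchIn-punchOut ab)) (trans (cong (punchIn a) (sym e)) (punchIn-punchOut ax)))

  avoid₃ : ∀ {N} (a x y : Fin (suc (suc (suc N)))) → x ≢ a → y ≢ a → x ≢ y →
           Σ (Fin N → Fin (suc (suc (suc N)))) λ f → Inj f × (∀ i → f i ≢ a) × (∀ i → f i ≢ x) × (∀ i → f i ≢ y)
  avoid₃ {N} a x y xa ya xy = f , finj , fa , fx , fy
    where
    ax : a ≢ x
    ax e = xa (sym e)
    ay : a ≢ y
    ay e = ya (sym e)
    y'≢x' : punchOut ay ≢ punchOut ax
    y'≢x' e = xy (sym (punchOut-injective ay ax e))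
    g = avoid₂ (punchOut ax) (punchOut ay) y'≢x'
    f : Fin N → Fin (suc (suc (suc N)))
    f i = punchIn a (proj₁ g i)
    finj : Inj f
    finj e = proj₁ (proj₂ g) (punchIn-injective a _ _ e)
    fa : ∀ i → f i ≢ a
    fa i = punchInᵢ≢i a _
    fx : ∀ i → f i ≢ x
    fx i e = proj₁ (proj₂ (proj₂ g)) i (punchIn-injective a _ _ (trans e (sym (punchIn-punchOut ax))))
    fy : ∀ i → f i ≢ y
    fy i e = proj₁ (proj₂ (proj₂ (proj₂ g))) i (punchIn-injective a _ _ (trans e (sym (punchIn-punchOut ay))))

  record MissesOne {N} (α : Fin (suc N) → Fin (suc (suc N))) : Set where
    field
      w     : Fin (suc (suc N))
      w∉    : ∀ k → α k ≢ w
      cover : ∀ a → a ≡ w ⊎ ∃ λ k → α k ≡ a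

  missesOne : ∀ {N} (α : Fin (suc N) → Fin (suc (suc N))) → Inj α → MissesOne α
  missesOne {N} α α-inj = record { w = w ; w∉ = λ k eq → ¬hit (k , eq) ; cover = cover }
    where
    Hit : Fin (suc (suc N)) → Set
    Hit a = ∃ λ k → α k ≡ a
    notOnto : ¬ (∀ a → Hit a)
    notOnto onto = ℕP.<-irrefl refl (injective⇒≤ {f = λ a → proj₁ (onto a)} inj)
      where
      inj : ∀ {a b} → proj₁ (onto a) ≡ proj₁ (onto b) → a ≡ b
      inj {a} {b} eq = trans (sym (proj₂ (onto a))) (trans (cong α eq) (proj₂ (onto b)))
    missed : ∃ λ w → ¬ Hit w
    missed with all? (λ a → any? (λ k → α k ≟F a))
    ... | yes onto = ⊥-elim (notOnto onto)
    ... | no ¬onto = ¬∀⟶∃¬ _ Hit (λ a → any? (λ k → α k ≟F a)) ¬onto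
    w = proj₁ missed
    ¬hit = proj₂ missed
    -- a second missed point a would make α an injection into Fin N
    cover : ∀ a → a ≡ w ⊎ Hit a
    cover a with a ≟F w | any? (λ k → α k ≟F a)
    ... | yes aw | _     = inj₁ aw
    ... | no _   | yes h = inj₂ h
    ... | no aw  | no ¬h = ⊥-elim (ℕP.<-irrefl refl (injective⇒≤ {f = f} finj))
      where
      w≢α : ∀ k → w ≢ α k
      w≢α k eq = ¬hit (k , sym eq)
      a' : Fin (suc N)
      a' = punchOut {i = w} {j = a} (λ eq → aw (sym eq))
      a'≢ : ∀ k → a' ≢ punchOut (w≢α k)
      a'≢ k eq = ¬h (k , sym (punchOut-injective {i = w} _ _ eq))
      f : Fin (suc N) → Fin N
      f k = punchOut (a'≢ k)
      finj : ∀ {k k'} → f k ≡ f k' → k ≡ k'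
      finj eq = α-inj (punchOut-injective {i = w} _ _ (punchOut-injective {i = a'} _ _ eq))

  argmin : ∀ {N} (P : Fin N → Set) → Decidable P → (f : Fin N → ℕ) → ∃ P →
           ∃ λ k → P k × (∀ k' → P k' → f k ≤ f k')
  argmin {suc N} P P? f ex with any? (λ k → P? (suc k))
  argmin {suc N} P P? f ex | yes r with argmin (λ k → P (suc k)) (λ k → P? (suc k)) (λ k → f (suc k)) r
  ... | k , pk , mn with P? zero
  ...   | no np0 = suc k , pk , λ { zero p0 → ⊥-elim (np0 p0) ; (suc k') pk' → mn k' pk' }
  ...   | yes p0 with f zero ≤? f (suc k)
  ...     | yes le = zero , p0 , λ { zero _ → ℕP.≤-refl ; (suc k') pk' → ℕP.≤-trans le (mn k' pk') }
  ...     | no gt = suc k , pk , λ { zero _ → ℕP.<⇒≤ (ℕP.≰⇒> gt) ; (suc k') pk' → mn k' pk' }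
  argmin {suc N} P P? f (zero , p0) | no nr =
    zero , p0 , λ { zero _ → ℕP.≤-refl ; (suc k') pk' → ⊥-elim (nr (k' , pk')) }
  argmin {suc N} P P? f (suc k , pk) | no nr = ⊥-elim (nr (k , pk))

  coveredByThree : ∀ {N} (a b c : Fin N) → (∀ k → k ≡ a ⊎ k ≡ b ⊎ k ≡ c) → N ≤ 3
  coveredByThree {N} a b c cv = injective⇒≤ {f = λ k → tag (cv k)} (λ {k} {k'} eq → untag (cv k) (cv k') eq)
    where
    tag : ∀ {k : Fin N} → k ≡ a ⊎ k ≡ b ⊎ k ≡ c → Fin 3
    tag (inj₁ _)        = zero
    tag (inj₂ (inj₁ _)) = suc zero
    tag (inj₂ (inj₂ _)) = suc (suc zero)
    untag : ∀ {k k'} (x : k ≡ a ⊎ k ≡ b ⊎ k ≡ c) (y : k' ≡ a ⊎ k' ≡ b ⊎ k' ≡ c) → tag x ≡ tag y → k ≡ k'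
    untag (inj₁ e1)        (inj₁ e2)        _ = trans e1 (sym e2)
    untag (inj₂ (inj₁ e1)) (inj₂ (inj₁ e2)) _ = trans e1 (sym e2)
    untag (inj₂ (inj₂ e1)) (inj₂ (inj₂ e2)) _ = trans e1 (sym e2)
    untag (inj₁ _)        (inj₂ (inj₁ _)) ()
    untag (inj₁ _)        (inj₂ (inj₂ _)) ()
    untag (inj₂ (inj₁ _)) (inj₁ _)        ()
    untag (inj₂ (inj₁ _)) (inj₂ (inj₂ _)) ()
    untag (inj₂ (inj₂ _)) (inj₁ _)        ()
    untag (inj₂ (inj₂ _)) (inj₂ (inj₁ _)) ()

  fourth : ∀ {N} → 4 ≤ N → (a b c : Fin N) → ∃ λ k → k ≢ a × k ≢ b × k ≢ c
  fourth 4≤N a b c with any? (λ k → ¬? (k ≟F a) ×-dec ¬? (k ≟F b) ×-dec ¬? (k ≟F c))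
  ... | yes found = found
  ... | no none = ⊥-elim (ℕP.<⇒≱ 4≤N (coveredByThree a b c covers))
    where
    covers : ∀ k → k ≡ a ⊎ k ≡ b ⊎ k ≡ c
    covers k with k ≟F a | k ≟F b | k ≟F c
    ... | yes ka | _      | _      = inj₁ ka
    ... | no _   | yes kb | _      = inj₂ (inj₁ kb)
    ... | no _   | no _   | yes kc = inj₂ (inj₂ kc)
    ... | no ka  | no kb  | no kc  = ⊥-elim (none (k , ka , kb , kc))

module Pd (e : ℕ) where

  open import Defs hiding (sym)
  open import Data.Nat using (ℕ; zero; suc; _+_; _*_; _≤_; _<_; s≤s; z≤n)
  import Data.Nat.Properties as ℕP
  open import Data.Fin using (Fin; zero; suc; toℕ; combine; inject≤)
  open import Data.Fin.Properties using (toℕ-injective; toℕ-combine; toℕ-inject≤; combine-injective; inject≤-injective; toℕ<n)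
  open import Data.Product using (Σ; _×_; _,_)
  open import Data.Sum using (_⊎_; inj₁; inj₂)
  open import Data.Empty using (⊥-elim)
  open import Relation.Nullary using (¬_)
  open import Relation.Binary.PropositionalEquality

  onPath : Fin 3 → Fin 3 → Fin (9 + e)
  onPath t r = inject≤ (combine t r) (s≤s (s≤s (s≤s (s≤s (s≤s (s≤s (s≤s (s≤s (s≤s z≤n)))))))))

  toℕ-onPath : ∀ t r → toℕ (onPath t r) ≡ 3 * toℕ t + toℕ r
  toℕ-onPath t r = trans (toℕ-inject≤ (combine t r) _) (toℕ-combine t r)

  onPath-injective : ∀ t r t' r' → onPath t r ≡ onPath t' r' → t ≡ t' × r ≡ r'
  onPath-injective t r t' r' eq = combine-injective t r t' r' (inject≤-injective _ _ _ _ eq)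

  -- the paths' vertices all lie below 9, hence outside the deleted matching
  onPath<9 : ∀ t r → toℕ (onPath t r) < 9
  onPath<9 t r = subst (_< 9) (sym (toℕ-inject≤ (combine t r) _)) (toℕ<n (combine t r))

  low mid high : Fin 3 → Fin (9 + e)
  low t  = onPath t zero
  mid t  = onPath t (suc zero)
  high t = onPath t (suc (suc zero))

  mid-injective : ∀ t t' → mid t ≡ mid t' → t ≡ t'
  mid-injective t t' eq with onPath-injective t (suc zero) t' (suc zero) eq
  ... | eq' , _ = eq'

  mid≢low : ∀ t t' → mid t' ≢ low t
  mid≢low t t' eq with onPath-injective t' (suc zero) t zero eq
  ... | _ , ()

  mid≢high : ∀ t t' → mid t' ≢ high t
  mid≢high t t' eq with onPath-injective t' (suc zero) t (suc (suc zero)) eq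
  ... | _ , ()

  low≢high : ∀ t → low t ≢ high t
  low≢high t eq with onPath-injective t zero t (suc (suc zero)) eq
  ... | _ , ()

  -- the middle vertices are exactly the vertices of degree d-2 in P_d, the
  -- ones joined to a bay
  toℕ≡mid : ∀ {a : Fin (9 + e)} t → toℕ a ≡ 3 * toℕ t + 1 → a ≡ mid t
  toℕ≡mid {a} t eq = toℕ-injective (trans eq (sym (toℕ-onPath t (suc zero))))

  toℕ-low : ∀ t → toℕ (low t) ≡ 3 * toℕ t
  toℕ-low t = trans (toℕ-onPath t zero) (ℕP.+-identityʳ (3 * toℕ t))

  toℕ-mid : ∀ t → toℕ (mid t) ≡ 3 * toℕ t + 1
  toℕ-mid t = toℕ-onPath t (suc zero)

  toℕ-high : ∀ t → toℕ (high t) ≡ 3 * toℕ t + 2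
  toℕ-high t = toℕ-onPath t (suc (suc zero))

  delSym : ∀ {a b} → Deleted a b → Deleted b a
  delSym (inj₁ x) = inj₂ x
  delSym (inj₂ x) = inj₁ x

  Partner : Fin 3 → Fin (9 + e) → Set
  Partner t p = p ≡ low t ⊎ p ≡ high t

  partnerDeleted : ∀ t p → Partner t p → Deleted (toℕ (mid t)) (toℕ p)
  partnerDeleted t p (inj₁ refl) =
    inj₁ (inj₁ (t , toℕ-mid t , inj₁ (toℕ-low t)))
  partnerDeleted t p (inj₂ refl) =
    inj₁ (inj₁ (t , toℕ-mid t , inj₂ (toℕ-high t)))

  partner≢mid : ∀ t p t' → Partner t p → p ≢ mid t'
  partner≢mid t p t' (inj₁ refl) eq = mid≢low t t' (sym eq)
  partner≢mid t p t' (inj₂ refl) eq = mid≢high t t' (sym eq)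

  mid≢matched : ∀ t k → toℕ (mid t) ≢ 9 + k
  mid≢matched t k eq = ℕP.<⇒≱ (onPath<9 t (suc zero)) (subst (9 ≤_) (sym eq) (ℕP.m≤m+n 9 k))

  deletedAtMid : ∀ t (b : Fin (9 + e)) → Deleted (toℕ (mid t)) (toℕ b) → Partner t b
  deletedAtMid t b (inj₁ (inj₁ (t' , em , eb))) with mid-injective t t' (toℕ≡mid t' em)
  ... | refl with eb
  ...   | inj₁ el = inj₁ (toℕ-injective (trans el (sym (toℕ-low t))))
  ...   | inj₂ eh = inj₂ (toℕ-injective (trans eh (sym (toℕ-high t))))
  deletedAtMid t b (inj₁ (inj₂ (k , em , _))) = ⊥-elim (mid≢matched t (2 * k) em)
  deletedAtMid t b (inj₂ (inj₁ (t' , _ , inj₁ em))) =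
    ⊥-elim (mid≢low t' t (toℕ-injective (trans em (sym (toℕ-low t')))))
  deletedAtMid t b (inj₂ (inj₁ (t' , _ , inj₂ em))) =
    ⊥-elim (mid≢high t' t (toℕ-injective (trans em (sym (toℕ-high t')))))
  deletedAtMid t b (inj₂ (inj₂ (k , _ , em))) = ⊥-elim (mid≢matched t (suc (2 * k)) em)

  -- a vertex that is no middle vertex has at most one deleted partner,
  -- namely partnerOf x (a value beyond d means: none)
  IsMid : ℕ → Set
  IsMid x = Σ (Fin 3) λ t → x ≡ 3 * toℕ t + 1

  matchPartner : ℕ → ℕ
  matchPartner zero          = 1
  matchPartner (suc zero)    = 0
  matchPartner (suc (suc j)) = suc (suc (matchPartner j))

  matchPartner-even : ∀ k → matchPartner (2 * k) ≡ suc (2 * k)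
  matchPartner-even zero = refl
  matchPartner-even (suc k) rewrite ℕP.+-suc k (k + 0) = cong (λ z → suc (suc z)) (matchPartner-even k)

  matchPartner-odd : ∀ k → matchPartner (suc (2 * k)) ≡ 2 * k
  matchPartner-odd zero = refl
  matchPartner-odd (suc k) rewrite ℕP.+-suc k (k + 0) = cong (λ z → suc (suc z)) (matchPartner-odd k)

  matchPartner≢ : ∀ j → matchPartner j ≢ j
  matchPartner≢ (suc (suc j)) eq = matchPartner≢ j (ℕP.suc-injective (ℕP.suc-injective eq))

  partnerOf : ℕ → ℕ
  partnerOf 0 = 1
  partnerOf 2 = 1
  partnerOf 3 = 4
  partnerOf 5 = 4
  partnerOf 6 = 7
  partnerOf 8 = 7
  partnerOf (suc (suc (suc (suc (suc (suc (suc (suc (suc j))))))))) = 9 + matchPartner j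
  partnerOf _ = 0

  deletedAtNonMid : ∀ x y → ¬ IsMid x → Deleted x y → y ≡ partnerOf x
  deletedAtNonMid x y nm (inj₁ (inj₁ (t , ex , _))) = ⊥-elim (nm (t , ex))
  deletedAtNonMid .(9 + 2 * k) .(10 + 2 * k) nm (inj₁ (inj₂ (k , refl , refl))) =
    cong (9 +_) (sym (matchPartner-even k))
  deletedAtNonMid x y nm (inj₂ (inj₁ (zero , refl , inj₁ refl))) = refl
  deletedAtNonMid x y nm (inj₂ (inj₁ (zero , refl , inj₂ refl))) = refl
  deletedAtNonMid x y nm (inj₂ (inj₁ (suc zero , refl , inj₁ refl))) = refl
  deletedAtNonMid x y nm (inj₂ (inj₁ (suc zero , refl , inj₂ refl))) = refl
  deletedAtNonMid x y nm (inj₂ (inj₁ (suc (suc zero) , refl , inj₁ refl))) = refl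
  deletedAtNonMid x y nm (inj₂ (inj₁ (suc (suc zero) , refl , inj₂ refl))) = refl
  deletedAtNonMid .(10 + 2 * k) .(9 + 2 * k) nm (inj₂ (inj₂ (k , refl , refl))) =
    cong (9 +_) (sym (matchPartner-odd k))

  partnerOf≢ : ∀ x → ¬ IsMid x → partnerOf x ≢ x
  partnerOf≢ 1 nm _ = nm (zero , refl)
  partnerOf≢ 4 nm _ = nm (suc zero , refl)
  partnerOf≢ 7 nm _ = nm (suc (suc zero) , refl)
  partnerOf≢ (suc (suc (suc (suc (suc (suc (suc (suc (suc j))))))))) nm eq =
    matchPartner≢ j (ℕP.+-cancelˡ-≡ 9 _ _ eq)

module Construction (e n m : ℕ) (bay : Fin m → Fin n) (tgt : Fin m → Fin 3 → Fin (6 + e)) where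

  open import Defs hiding (sym)
  open Encoding
  open Immersions
  open Pd e
  open import Data.Nat using (suc; _*_)
  import Data.Nat.Properties as ℕP
  open import Data.Fin using (toℕ; punchOut)
  open import Data.Fin.Properties using (toℕ-injective; toℕ<n; punchOut-injective; injective⇒≤) renaming (_≟_ to _≟F_)
  open import Data.Product using (Σ; _×_; _,_; proj₁; proj₂)
  open import Data.Sum using (_⊎_; inj₁; inj₂)
  open import Data.Empty using (⊥; ⊥-elim)
  open import Relation.Nullary using (¬_; no)
  open import Relation.Unary using (Decidable)
  open import Relation.Binary.PropositionalEquality

  d : ℕ
  d = 8 + e

  G : Graph
  G = Gnd d n m bay tgt

  V : Set
  V = Fin (Size d n m)

  dec : V → Vtx d n m
  dec = decode d n m

  enc : Vtx d n m → V
  enc = encode d n m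

  dec-inj : ∀ {u v} → dec u ≡ dec v → u ≡ v
  dec-inj = decode-inj d n m

  enc-dec : ∀ v → enc (dec v) ≡ v
  enc-dec = encode-decode d n m

  dec-enc : ∀ v → dec (enc v) ≡ v
  dec-enc = decode-encode d n m

  data Decoded (v : V) : Set where
    isBay  : ∀ i p → dec v ≡ bayV i p → Decoded v
    isCopy : ∀ c a → dec v ≡ copyV c a → Decoded v

  decoded : ∀ v → Decoded v
  decoded v with dec v in ev
  ... | bayV i p  = isBay i p ev
  ... | copyV c a = isCopy c a ev

  adjView : ∀ {u v X Y} → Adj G u v → dec u ≡ X → dec v ≡ Y →
            RawAdj d n m bay tgt X Y ⊎ RawAdj d n m bay tgt Y X
  adjView (_ , r) refl refl = r

  adjCC : ∀ {u v c a c' b} → Adj G u v → dec u ≡ copyV c a → dec v ≡ copyV c' b →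
          c ≡ c' × ¬ Deleted (toℕ a) (toℕ b) × a ≢ b
  adjCC {a = a} adj@(u≢v , _) du dv with adjView adj du dv
  ... | inj₁ (refl , nd) = refl , nd , λ { refl → u≢v (dec-inj (trans du (sym dv))) }
  ... | inj₂ (refl , nd) = refl , (λ z → nd (delSym z)) , λ { refl → u≢v (dec-inj (trans du (sym dv))) }

  adjCB : ∀ {u v c a i p} → Adj G u v → dec u ≡ copyV c a → dec v ≡ bayV i p →
          Σ (Fin 3) λ t → toℕ a ≡ 3 * toℕ t + 1 × i ≡ bay c × p ≡ tgt c t
  adjCB adj du dv with adjView adj du dv
  ... | inj₁ x = x

  copyV-injective : ∀ {c c' a a'} → copyV {d} {n} {m} c a ≡ copyV c' a' → a ≡ a'
  copyV-injective refl = refl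

  copyAdj : ∀ c a b → a ≢ b → ¬ Deleted (toℕ a) (toℕ b) → Adj G (enc (copyV c a)) (enc (copyV c b))
  copyAdj c a b ab nd =
    (λ eq → ab (copyV-injective (trans (sym (dec-enc (copyV c a))) (trans (cong dec eq) (dec-enc (copyV c b)))))) ,
    inj₁ (subst₂ (RawAdj d n m bay tgt) (sym (dec-enc (copyV c a))) (sym (dec-enc (copyV c b))) (refl , nd))

  midAdj : ∀ c t → Adj G (enc (copyV c (mid t))) (enc (bayV (bay c) (tgt c t)))
  midAdj c t =
    (λ eq → copy≢bay (trans (sym (dec-enc (copyV c (mid t)))) (trans (cong dec eq) (dec-enc _)))) ,
    inj₁ (subst₂ (RawAdj d n m bay tgt) (sym (dec-enc (copyV c (mid t)))) (sym (dec-enc (bayV (bay c) (tgt c t))))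
                 (t , toℕ-mid t , refl , refl))
    where
    copy≢bay : ∀ {x y z w} → copyV {d} {n} {m} x y ≢ bayV z w
    copy≢bay ()

  predUnique : ∀ {i' i'' i : Fin n} → PredMod n i' i → PredMod n i'' i → i' ≡ i''
  predUnique (inj₁ e1) (inj₁ e2) = toℕ-injective (ℕP.suc-injective (trans e1 (sym e2)))
  predUnique (inj₁ e1) (inj₂ (z , _)) with trans e1 z
  ... | ()
  predUnique (inj₂ (z , _)) (inj₁ e2) with trans e2 z
  ... | ()
  predUnique (inj₂ (_ , e1)) (inj₂ (_ , e2)) = toℕ-injective (ℕP.suc-injective (trans e1 (sym e2)))

  succUnique : ∀ {i' i i₂ : Fin n} → PredMod n i' i → PredMod n i' i₂ → i ≡ i₂
  succUnique (inj₁ e1) (inj₁ e2) = toℕ-injective (trans (sym e1) e2)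
  succUnique {i = i} (inj₁ e1) (inj₂ (_ , e2)) = ⊥-elim (ℕP.<-irrefl (trans (sym e1) e2) (toℕ<n i))
  succUnique {i₂ = i₂} (inj₂ (_ , e2)) (inj₁ e1) = ⊥-elim (ℕP.<-irrefl (trans (sym e1) e2) (toℕ<n i₂))
  succUnique (inj₂ (z1 , _)) (inj₂ (z2 , _)) = toℕ-injective (trans z1 (sym z2))

  ringPartner : ∀ {i i' i₂ i₂'} {p q q'} → Ring d n i p i' q → Ring d n i₂ p i₂' q' → q ≡ q'
  ringPartner {p = p} r r' = toℕ-injective (ℕP.suc-injective
    (ℕP.+-cancelˡ-≡ (label p) _ _ (trans (proj₂ (proj₂ r)) (sym (proj₂ (proj₂ r'))))))

  bayOf : Vtx d n m → Fin n
  bayOf (bayV i _)  = i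
  bayOf (copyV c _) = bay c

  -- a neighbour v of the copy vertex copyV c a, labelled by a vertex of P_d
  -- other than a: its own label if it lies in the copy, low t if it is the
  -- bay vertex joined to a = mid t
  module Neighbours (y : V) (c : Fin m) (a : Fin (suc d)) (dy : dec y ≡ copyV c a) where
    NbLabel : V → Fin (suc d) → Set
    NbLabel v idx = (dec v ≡ copyV c idx × ¬ Deleted (toℕ a) (toℕ idx) × a ≢ idx)
                  ⊎ (Σ (Fin 3) λ t → dec v ≡ bayV (bay c) (tgt c t) × a ≡ mid t × idx ≡ low t)

    nbLabel : ∀ v → Adj G y v → Σ (Fin (suc d)) (NbLabel v)
    nbLabel v adj with decoded v
    ... | isCopy c' b ev = let (cc , nd , nab) = adjCC adj dy ev in
                       b , inj₁ (subst (λ z → dec v ≡ copyV z b) (sym cc) ev , nd , nab)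
    ... | isBay i q ev   = let (t , ea , ei , eq) = adjCB adj dy ev in
                       low t , inj₂ (t , trans ev (cong₂ bayV ei eq) , toℕ≡mid t ea , refl)

    nbLabel≢ : ∀ v idx → NbLabel v idx → idx ≢ a
    nbLabel≢ v idx (inj₁ (_ , _ , nab)) eq = nab (sym eq)
    nbLabel≢ v idx (inj₂ (t , _ , am , refl)) eq = mid≢low t t (trans (sym am) (sym eq))

    lowDeleted : ∀ t → a ≡ mid t → Deleted (toℕ a) (toℕ (low t))
    lowDeleted t refl = partnerDeleted t (low t) (inj₁ refl)

    nbLabel-inj : ∀ v v' idx → NbLabel v idx → NbLabel v' idx → v ≡ v'
    nbLabel-inj v v' idx (inj₁ (e1 , _)) (inj₁ (e2 , _)) = dec-inj (trans e1 (sym e2))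
    nbLabel-inj v v' idx (inj₂ (t , e1 , am , refl)) (inj₂ (t' , e2 , am' , eq))
      with mid-injective t t' (trans (sym am) am')
    ... | refl = dec-inj (trans e1 (sym e2))
    nbLabel-inj v v' idx (inj₁ (_ , nd , _)) (inj₂ (t , _ , am , refl)) = ⊥-elim (nd (lowDeleted t am))
    nbLabel-inj v v' idx (inj₂ (t , _ , am , refl)) (inj₁ (_ , nd , _)) = ⊥-elim (nd (lowDeleted t am))

  -- every copy vertex has degree at most d: injective labels avoiding a
  copyDegree≤ : ∀ y c a → dec y ≡ copyV c a → ¬ DegAtLeast G y (suc d)
  copyDegree≤ y c a dy (g , ginj , gadj) = ℕP.<-irrefl refl (injective⇒≤ {f = h} hinj)
    where
    open Neighbours y c a dy
    labelOf : ∀ p → Σ (Fin (suc d)) (NbLabel (g p))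
    labelOf p = nbLabel (g p) (gadj p)
    h : Fin (suc d) → Fin d
    h p = punchOut {i = a} {j = proj₁ (labelOf p)} (λ eq → nbLabel≢ (g p) _ (proj₂ (labelOf p)) (sym eq))
    hinj : ∀ {p q} → h p ≡ h q → p ≡ q
    hinj {p} {q} eq = ginj p q (nbLabel-inj (g p) (g q) _ (proj₂ (labelOf p))
                                  (subst (NbLabel (g q)) (sym sameLabel) (proj₂ (labelOf q))))
      where
      sameLabel : proj₁ (labelOf p) ≡ proj₁ (labelOf q)
      sameLabel = punchOut-injective {i = a} _ _ eq

  IsCopy : Fin m → Vtx d n m → Set
  IsCopy c (copyV c' _) = c' ≡ c
  IsCopy c (bayV _ _)   = ⊥

  InC : Fin m → V → Set
  InC c v = IsCopy c (dec v)

  InC? : ∀ c → Decidable (InC c)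
  InC? c v with dec v
  ... | copyV c' _ = c' ≟F c
  ... | bayV _ _   = no (λ ())

  InC-dec : ∀ {c v} → InC c v → Σ (Fin (suc d)) λ x → dec v ≡ copyV c x
  InC-dec {c} {v} ic with dec v | ic
  ... | copyV c' x | refl = x , refl

  leavingCopy : ∀ c a b → InC c a → ¬ InC c b → Adj G a b →
                Σ (Fin 3) λ t → dec a ≡ copyV c (mid t) × dec b ≡ bayV (bay c) (tgt c t)
  leavingCopy c a b ia nib adj with InC-dec ia | decoded b
  ... | x , ea | isCopy c' y eb = ⊥-elim (nib (subst (IsCopy c) (sym eb) (sym (proj₁ (adjCC adj ea eb)))))
  ... | x , ea | isBay i q eb with adjCB adj ea eb
  ...   | t , ex , ei , eq = t , trans ea (cong (copyV c) (toℕ≡mid t ex)) , trans eb (cong₂ bayV ei eq)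

  copyCut : ∀ c → CutAtMost G (InC c) 3
  copyCut c = record { code = λ a b ia nib adj → proj₁ (leavingCopy c a b ia nib adj)
                     ; code-inj = λ a b a' b' ia nib adj ia' nib' adj' →
                         sameEdge (leavingCopy c a b ia nib adj) (leavingCopy c a' b' ia' nib' adj') }
    where
    sameEdge : ∀ {a b a' b'} (X : Σ (Fin 3) λ t → dec a ≡ copyV c (mid t) × dec b ≡ bayV (bay c) (tgt c t))
               (Y : Σ (Fin 3) λ t → dec a' ≡ copyV c (mid t) × dec b' ≡ bayV (bay c) (tgt c t)) →
               proj₁ X ≡ proj₁ Y → a ≡ a' × b ≡ b'
    sameEdge (t , e1 , e2) (.t , e1' , e2') refl = dec-inj (trans e1 (sym e1')) , dec-inj (trans e2 (sym e2'))

module CopyCase (e n m : ℕ) (bay : Fin m → Fin n) (tgt : Fin m → Fin 3 → Fin (6 + e)) where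

  open import Defs hiding (sym)
  open Walks
  open Immersions
  open Pairs
  open FinFacts
  open Pd e
  open Construction e n m bay tgt
  open import Data.Nat using (suc; _≤_; s≤s)
  open import Data.Fin using (zero; suc; toℕ)
  open import Data.Fin.Properties using (any?) renaming (_≟_ to _≟F_)
  open import Data.List.Membership.Propositional using (_∈_)
  open import Data.Product using (Σ; ∃; _×_; _,_; proj₁; proj₂)
  open import Data.Sum using (_⊎_; inj₁; inj₂)
  open import Data.Empty using (⊥; ⊥-elim)
  open import Relation.Nullary using (¬_; yes; no)
  open import Relation.Binary.PropositionalEquality

  module _ (I : Immersion (K d) G) where
    open Branching G (7 + e) I
    open Immersion I using (φ; φ-inj)

    -- a copy holding some but not all branch vertices is separated from the
    -- rest by d-1 pairs, but its cut has only 3 edges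
    splitCopy : ∀ c i₀ j₀ → InC c (φ i₀) → ¬ InC c (φ j₀) → ⊥
    splitCopy c i₀ j₀ in₀ out₀ =
      tooMany (cutBound (InC? c) (copyCut c) (separatedPairs₁ (λ k → InC? c (φ k)) i₀ j₀ in₀ out₀))
      where
      tooMany : ¬ (7 + e ≤ 3)
      tooMany (s≤s (s≤s (s≤s ())))

    -- all branch vertices inside the copy c: the d branch vertices occupy all
    -- vertices of the copy but one, w
    module Inside (c : Fin m) (inside : ∀ k → InC c (φ k)) where

      -- kept abstract: unfolding the decoding makes type checking blow up
      abstract
        α : Fin d → Fin (suc d)
        α k = proj₁ (InC-dec (inside k))

        hα : ∀ k → dec (φ k) ≡ copyV c (α k)
        hα k = proj₂ (InC-dec (inside k))

      α-inj : ∀ {k k'} → α k ≡ α k' → k ≡ k'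
      α-inj {k} {k'} eq = φ-inj k k' (dec-inj (trans (hα k) (trans (cong (copyV c) eq) (sym (hα k')))))

      abstract
        missing : MissesOne α
        missing = missesOne α α-inj

      open MissesOne missing

      branchOf : ∀ a → a ≢ w → ∃ λ k → α k ≡ a
      branchOf a aw with cover a
      ... | inj₁ eq = ⊥-elim (aw eq)
      ... | inj₂ p  = p

      wV : V
      wV = enc (copyV c w)

      extE : Fin 3 → V
      extE t = enc (bayV (bay c) (tgt c t))

      -- copy vertices have degree at most d, so no branch vertex is an
      -- interior vertex of a path of the immersion
      notInterior : ∀ z {i j} (s : Seg i j) → z ≢ i → z ≢ j → φ z ∈ vertices (W s) → ⊥
      notInterior z s zi zj mem = copyDegree≤ (φ z) c (α z) (hα z) (branchOnPath z s zi zj mem)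

      -- how the path from a middle vertex to one of its partners can leave
      -- the middle vertex: straight to w, or (when w is a middle vertex)
      -- through the bay, coming back over the edge from the bay to w
      Exit : ∀ {kx kp} → Seg kx kp → Set
      Exit {kx} s = EdgeIn (φ kx) wV (W s)
                  ⊎ Σ (Fin 3) (λ tw → w ≡ mid tw × EdgeIn (extE tw) wV (W s))

      φ≡ : ∀ {v z b} → dec v ≡ copyV c b → α z ≡ b → φ z ≡ v
      φ≡ {v} {z} ev az = dec-inj (trans (hα z) (trans (cong (copyV c) az) (sym ev)))

      enc≡ : ∀ {v X} → dec v ≡ X → enc X ≡ v
      enc≡ {v} refl = enc-dec v

      onPathIsW : ∀ {kx kp} (s : Seg kx kp) {v b} → dec v ≡ copyV c b → v ∈ vertices (W s) →
                  v ≢ φ kx → b ≢ α kp → b ≡ w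
      onPathIsW {kx} {kp} s {v} {b} ev mem v≢ b≢ with cover b
      ... | inj₁ bw = bw
      ... | inj₂ (z , az) = ⊥-elim (notInterior z s z≢kx z≢kp (subst (_∈ vertices (W s)) (sym (φ≡ ev az)) mem))
        where
        z≢kx : z ≢ kx
        z≢kx refl = v≢ (sym (φ≡ ev az))
        z≢kp : z ≢ kp
        z≢kp refl = b≢ (sym az)

      exitFromMid : ∀ t kx kp → α kx ≡ mid t → Partner t (α kp) → (ne : kx ≢ kp) → Exit (seg kx kp ne)
      exitFromMid t kx kp ax ap ne = firstStep (decoded v₁)
        where
        s = seg kx kp ne
        v₁ = proj₁ (edgeAt s)
        ev₁ : EdgeIn (φ kx) v₁ (W s)
        ev₁ = proj₂ (edgeAt s)
        deleted : Deleted (toℕ (α kx)) (toℕ (α kp))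
        deleted = subst (λ z → Deleted (toℕ z) (toℕ (α kp))) (sym ax) (partnerDeleted t (α kp) ap)

        -- the path re-enters the copy over an edge o r with r ≠ φ kx; then r
        -- is w, and o is the bay vertex joined to w = mid t'
        returnStep : ∀ {o r} → ¬ InC c o → InC c r → EdgeIn o r (W s) → r ≢ φ kx → Exit s
        returnStep {o} out inr eor r≢ with InC-dec inr | decoded o
        ... | b , er | isCopy c' _ eo =
              ⊥-elim (out (subst (IsCopy c) (sym eo) (sym (proj₁ (adjCC (Graph.sym G (EdgeIn⇒Adj (W s) eor)) er eo)))))
        ... | b , er | isBay i q eo with adjCB (Graph.sym G (EdgeIn⇒Adj (W s) eor)) er eo
        ...   | t' , eb , ei , eq
                with onPathIsW s er (EdgeIn⇒∈ʳ (W s) eor) r≢ (λ b≡ → partner≢mid t (α kp) t' ap (trans (sym b≡) (toℕ≡mid t' eb)))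
        ...     | refl = inj₂ (t' , toℕ≡mid t' eb ,
                               subst₂ (λ P Q → EdgeIn P Q (W s)) (sym (enc≡ (trans eo (cong₂ bayV ei eq)))) (sym (enc≡ er)) eor)

        -- the first edge goes to a copy vertex, which must be w, or leaves
        -- the copy, and then the path has to come back
        firstStep : Decoded v₁ → Exit s
        firstStep (isCopy c' b eb) with adjCC (EdgeIn⇒Adj (W s) ev₁) (hα kx) eb
        ... | refl , nd , _
              with onPathIsW s eb (EdgeIn⇒∈ʳ (W s) ev₁) (λ eq → Graph.irrefl G (subst (Adj G (φ kx)) eq (EdgeIn⇒Adj (W s) ev₁)))
                             (λ b≡ → nd (subst (λ q → Deleted (toℕ (α kx)) (toℕ q)) (sym b≡) deleted))
        ...   | refl = inj₁ (subst (λ z → EdgeIn (φ kx) z (W s)) (sym (enc≡ eb)) ev₁)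
        firstStep (isBay i q eb) =
          let (o , r , out , inr , eor , r≢) = returnEdge (InC? c) (W s) (Wpath s) (inside (x s)) (inside (y s)) ev₁
                                                (inside kx) (λ ic → subst (IsCopy c) eb ic)
          in returnStep out inr eor r≢

      partner≢ : ∀ t {kx kp} → α kx ≡ mid t → Partner t (α kp) → kx ≢ kp
      partner≢ t ax ap refl = partner≢mid t _ t ap ax

      -- the two paths from mid t to low t and to high t cannot both leave
      -- mid t straight to w: they would share that edge
      notBothDirect : ∀ t kx kl kh (ax : α kx ≡ mid t) (al : α kl ≡ low t) (ah : α kh ≡ high t) →
        EdgeIn (φ kx) wV (W (seg kx kl (partner≢ t ax (inj₁ al)))) →
        EdgeIn (φ kx) wV (W (seg kx kh (partner≢ t ax (inj₂ ah)))) → ⊥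
      notBothDirect t kx kl kh ax al ah p q
        with segDisj (seg kx kl (partner≢ t ax (inj₁ al))) (seg kx kh (partner≢ t ax (inj₂ ah))) p q
      ... | inj₁ (_ , refl) = low≢high t (trans (sym al) ah)
      ... | inj₂ (refl , _) = mid≢high t t (trans (sym ax) ah)

      record Detour (tx : Fin 3) : Set where
        field
          kx kp : Fin d
          ax    : α kx ≡ mid tx
          ap    : Partner tx (α kp)
          tw    : Fin 3
          wm    : w ≡ mid tw
          E     : EdgeIn (extE tw) wV (W (seg kx kp (partner≢ tx ax ap)))

      detour : ∀ tx tw → w ≡ mid tw → tx ≢ tw → Detour tx
      detour tx tw wm tx≢tw
        with branchOf (mid tx) (λ eq → tx≢tw (mid-injective tx tw (trans eq wm)))
           | branchOf (low tx) (λ eq → mid≢low tx tw (trans (sym wm) (sym eq)))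
           | branchOf (high tx) (λ eq → mid≢high tx tw (trans (sym wm) (sym eq)))
      ... | kx , ax | kl , al | kh , ah
        with exitFromMid tx kx kl ax (inj₁ al) (partner≢ tx ax (inj₁ al))
           | exitFromMid tx kx kh ax (inj₂ ah) (partner≢ tx ax (inj₂ ah))
      ...   | inj₂ (tw' , wm' , E) | _ = record { kx = kx ; kp = kl ; ax = ax ; ap = inj₁ al ; tw = tw' ; wm = wm' ; E = E }
      ...   | inj₁ _ | inj₂ (tw' , wm' , E) = record { kx = kx ; kp = kh ; ax = ax ; ap = inj₂ ah ; tw = tw' ; wm = wm' ; E = E }
      ...   | inj₁ p | inj₁ q = ⊥-elim (notBothDirect tx kx kl kh ax al ah p q)

      -- w a middle vertex: the detours of the two other deleted paths both
      -- use the single edge between the bay and w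
      wIsMid : ∀ tw tx ty → w ≡ mid tw → tx ≢ tw → ty ≢ tw → tx ≢ ty → ⊥
      wIsMid tw tx ty wm txw tyw txy with detour tx tw wm txw | detour ty tw wm tyw
      ... | X | Y with mid-injective (Detour.tw X) (Detour.tw Y) (trans (sym (Detour.wm X)) (Detour.wm Y))
      ...   | refl with segDisj (seg (Detour.kx X) (Detour.kp X) (partner≢ tx (Detour.ax X) (Detour.ap X)))
                               (seg (Detour.kx Y) (Detour.kp Y) (partner≢ ty (Detour.ax Y) (Detour.ap Y)))
                               (Detour.E X) (Detour.E Y)
      ...     | inj₁ (ek , _) = txy (mid-injective tx ty (trans (sym (Detour.ax X)) (trans (cong α ek) (Detour.ax Y))))
      ...     | inj₂ (ek , _) = partner≢mid ty _ tx (Detour.ap Y) (trans (cong α (sym ek)) (Detour.ax X))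

      -- mid 0 is not adjacent to its partners, so its path cannot go straight to w
      -- when w is a partner of mid 0
      notDirect : ∀ {kx kp} (ne : kx ≢ kp) → α kx ≡ mid zero → Partner zero w →
                  EdgeIn (φ kx) wV (W (seg kx kp ne)) → ⊥
      notDirect {kx} ne ax pw p with adjCC (EdgeIn⇒Adj (W (seg _ _ ne)) p) (hα kx) (dec-enc (copyV c w))
      ... | _ , nd , _ = nd (subst (λ z → Deleted (toℕ z) (toℕ w)) (sym ax) (partnerDeleted zero w pw))

      -- w no middle vertex: the paths from mid 0 to low 0 and high 0 (those
      -- that are branch vertices) have nowhere to go
      wNotMid : (∀ t → w ≢ mid t) → ⊥
      wNotMid nm with branchOf (mid zero) (λ eq → nm zero (sym eq)) | cover (low zero) | cover (high zero)
      ... | kx , ax | inj₂ (kl , al) | inj₂ (kh , ah)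
          with exitFromMid zero kx kl ax (inj₁ al) (partner≢ zero ax (inj₁ al))
             | exitFromMid zero kx kh ax (inj₂ ah) (partner≢ zero ax (inj₂ ah))
      ...   | inj₂ (tw , wm , _) | _ = nm tw wm
      ...   | inj₁ _ | inj₂ (tw , wm , _) = nm tw wm
      ...   | inj₁ p | inj₁ q = notBothDirect zero kx kl kh ax al ah p q
      wNotMid nm | kx , ax | inj₁ lw | _ with branchOf (high zero) (λ eq → low≢high zero (trans lw (sym eq)))
      ... | kh , ah with exitFromMid zero kx kh ax (inj₂ ah) (partner≢ zero ax (inj₂ ah))
      ...   | inj₂ (tw , wm , _) = nm tw wm
      ...   | inj₁ p = notDirect _ ax (inj₁ (sym lw)) p
      wNotMid nm | kx , ax | inj₂ _ | inj₁ hw with branchOf (low zero) (λ eq → low≢high zero (trans eq (sym hw)))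
      ... | kl , al with exitFromMid zero kx kl ax (inj₁ al) (partner≢ zero ax (inj₁ al))
      ...   | inj₂ (tw , wm , _) = nm tw wm
      ...   | inj₁ p = notDirect _ ax (inj₂ (sym hw)) p

      allInside : ⊥
      allInside with any? (λ t → w ≟F mid t)
      ... | no nm = wNotMid (λ t eq → nm (t , eq))
      ... | yes (zero , wm)             = wIsMid zero (suc zero) (suc (suc zero)) wm (λ ()) (λ ()) (λ ())
      ... | yes (suc zero , wm)         = wIsMid (suc zero) zero (suc (suc zero)) wm (λ ()) (λ ()) (λ ())
      ... | yes (suc (suc zero) , wm)   = wIsMid (suc (suc zero)) zero (suc zero) wm (λ ()) (λ ()) (λ ())

module BayCase (e n m : ℕ) (bay : Fin m → Fin n) (tgt : Fin m → Fin 3 → Fin (6 + e)) where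

  open import Defs hiding (sym)
  open Immersions
  open Pairs
  open FinFacts
  open Construction e n m bay tgt
  open import Data.Nat using (zero; suc; _≤_; _<_; z≤n; s≤s; _≤?_; ⌈_/2⌉)
  import Data.Nat.Properties as ℕP
  open import Data.Fin using (zero; suc; toℕ; punchIn; join; fromℕ<)
  open import Data.Fin.Properties using (toℕ-injective; punchIn-injective; punchInᵢ≢i; injective⇒≤; any?; toℕ<n; toℕ-fromℕ<) renaming (_≟_ to _≟F_)
  open import Data.Product using (Σ; _×_; _,_; proj₁; proj₂)
  open import Data.Sum using (_⊎_; inj₁; inj₂)
  open import Data.Sum.Properties using (inj₁-injective; inj₂-injective)
  open import Data.Empty using (⊥; ⊥-elim)
  open import Data.Unit using (⊤; tt)
  open import Relation.Nullary using (¬_; yes; no; ¬?)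
  open import Relation.Nullary.Decidable using (_×-dec_)
  open import Relation.Unary using (Decidable)
  open import Relation.Binary.PropositionalEquality

  -- consecutive bays are joined by at most c₂ = ⌈(d-2)/2⌉ ring edges, and
  -- two such bundles have fewer than d edges
  c₂ : ℕ
  c₂ = ⌈ 6 + e /2⌉

  ⌈/2⌉-double : ∀ k → ⌈ k /2⌉ + ⌈ k /2⌉ ≤ suc k
  ⌈/2⌉-double zero = z≤n
  ⌈/2⌉-double (suc zero) = s≤s (s≤s z≤n)
  ⌈/2⌉-double (suc (suc k)) rewrite ℕP.+-suc ⌈ k /2⌉ ⌈ k /2⌉ = s≤s (s≤s (⌈/2⌉-double k))

  -- the arc of bays lo, lo+1, ..., hi (not wrapping around)
  module Arc (lo hi : ℕ) (hi<n : hi < n) where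
    InArc : Fin n → Set
    InArc i = lo ≤ toℕ i × toℕ i ≤ hi

    InArc? : Decidable InArc
    InArc? i = (lo ≤? toℕ i) ×-dec (toℕ i ≤? hi)

    leavesAtLo : ∀ {i' i} → PredMod n i' i → InArc i → ¬ InArc i' → toℕ i ≡ lo
    leavesAtLo {i'} {i} pm (l , h) ni' with ℕP.m≤n⇒m<n∨m≡n l
    ... | inj₂ eq = sym eq
    ... | inj₁ lt with pm
    ...   | inj₁ e1 = ⊥-elim (ni' (ℕP.≤-pred (subst (lo <_) (sym e1) lt) ,
                                   ℕP.≤-trans (ℕP.n≤1+n _) (subst (_≤ hi) (sym e1) h)))
    ...   | inj₂ (z , _) = ⊥-elim (ℕP.<⇒≱ lt (subst (_≤ lo) (sym z) z≤n))

    leavesAtHi : ∀ {i' i} → PredMod n i' i → ¬ InArc i → InArc i' → toℕ i' ≡ hi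
    leavesAtHi {i'} {i} pm ni (l , h) with ℕP.m≤n⇒m<n∨m≡n h
    ... | inj₂ eq = eq
    ... | inj₁ lt with pm
    ...   | inj₁ e1 = ⊥-elim (ni (ℕP.≤-trans l (subst (toℕ i' ≤_) e1 (ℕP.n≤1+n _)) , subst (_≤ hi) e1 lt))
    ...   | inj₂ (_ , e2) = ⊥-elim (ℕP.<-irrefl refl (ℕP.<-≤-trans hi<n (subst (_≤ hi) e2 lt)))

    -- vertices of G lying in (or, for copies, attached to) the arc
    InArcV : V → Set
    InArcV v = InArc (bayOf (dec v))

    InArcV? : Decidable InArcV
    InArcV? v = InArc? (bayOf (dec v))

    record RingEdge (a b : V) (End : Fin n → Fin n → Set) : Set where
      field
        i i' : Fin n
        p q  : Fin (6 + e)
        ea   : dec a ≡ bayV i p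
        eb   : dec b ≡ bayV i' q
        r    : Ring d n i p i' q
        end  : End i i'

    AtLo AtHi : Fin n → Fin n → Set
    AtLo i i' = toℕ i ≡ lo
    AtHi i i' = toℕ i' ≡ hi

    CutEdge : V → V → Set
    CutEdge a b = RingEdge a b AtLo ⊎ RingEdge b a AtHi

    cutEdge : ∀ a b → InArcV a → ¬ InArcV b → Adj G a b → CutEdge a b
    cutEdge a b sa nsb adj with decoded a | decoded b
    ... | isCopy c x ea | isCopy c' y eb = ⊥-elim (nsb (subst InArc sameBay sa))
      where sameBay = trans (cong bayOf ea) (trans (cong bay (proj₁ (adjCC adj ea eb))) (sym (cong bayOf eb)))
    ... | isCopy c x ea | isBay i q eb with adjCB adj ea eb
    ...   | _ , _ , ei , _ = ⊥-elim (nsb (subst InArc (trans (cong bayOf ea) (trans (sym ei) (sym (cong bayOf eb)))) sa))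
    cutEdge a b sa nsb adj | isBay i p ea | isCopy c y eb with adjCB (Graph.sym G adj) eb ea
    ...   | _ , _ , ei , _ = ⊥-elim (nsb (subst InArc (trans (cong bayOf ea) (trans ei (sym (cong bayOf eb)))) sa))
    cutEdge a b sa nsb adj | isBay i p ea | isBay i' q eb with adjView adj ea eb
    ... | inj₁ (inj₁ refl) = ⊥-elim (nsb (subst InArc (trans (cong bayOf ea) (sym (cong bayOf eb))) sa))
    ... | inj₂ (inj₁ refl) = ⊥-elim (nsb (subst InArc (trans (cong bayOf ea) (sym (cong bayOf eb))) sa))
    ... | inj₁ (inj₂ r) = inj₁ (record { i = i ; i' = i' ; p = p ; q = q ; ea = ea ; eb = eb ; r = r
                                       ; end = leavesAtLo (proj₁ r) (subst (λ z → InArc (bayOf z)) ea sa)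
                                                 (λ ia → nsb (subst (λ z → InArc (bayOf z)) (sym eb) ia)) })
    ... | inj₂ (inj₂ r) = inj₂ (record { i = i' ; i' = i ; p = q ; q = p ; ea = eb ; eb = ea ; r = r
                                       ; end = leavesAtHi (proj₁ r) (λ ia → nsb (subst (λ z → InArc (bayOf z)) (sym eb) ia))
                                                 (subst (λ z → InArc (bayOf z)) ea sa) })

    -- a cut edge at either end is determined by the label p ≤ c₂
    sameAtLo : ∀ {a b a' b'} (C : RingEdge a b AtLo) (C' : RingEdge a' b' AtLo) →
               RingEdge.p C ≡ RingEdge.p C' → a ≡ a' × b ≡ b'
    sameAtLo C C' refl with toℕ-injective (trans (RingEdge.end C) (sym (RingEdge.end C')))
    ... | refl with predUnique (proj₁ (RingEdge.r C)) (proj₁ (RingEdge.r C')) | ringPartner (RingEdge.r C) (RingEdge.r C')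
    ...   | refl | refl = dec-inj (trans (RingEdge.ea C) (sym (RingEdge.ea C'))) ,
                          dec-inj (trans (RingEdge.eb C) (sym (RingEdge.eb C')))

    sameAtHi : ∀ {a b a' b'} (C : RingEdge a b AtHi) (C' : RingEdge a' b' AtHi) →
               RingEdge.p C ≡ RingEdge.p C' → a ≡ a' × b ≡ b'
    sameAtHi C C' refl with toℕ-injective (trans (RingEdge.end C) (sym (RingEdge.end C')))
    ... | refl with succUnique (proj₁ (RingEdge.r C)) (proj₁ (RingEdge.r C')) | ringPartner (RingEdge.r C) (RingEdge.r C')
    ...   | refl | refl = dec-inj (trans (RingEdge.ea C) (sym (RingEdge.ea C'))) ,
                          dec-inj (trans (RingEdge.eb C) (sym (RingEdge.eb C')))

    position : ∀ {a b End} → RingEdge a b End → Fin c₂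
    position C = fromℕ< (proj₁ (proj₂ (RingEdge.r C)))

    position-inj : ∀ {a b a' b' End End'} (C : RingEdge a b End) (C' : RingEdge a' b' End') →
                   position C ≡ position C' → RingEdge.p C ≡ RingEdge.p C'
    position-inj C C' eq = toℕ-injective
      (trans (sym (toℕ-fromℕ< (proj₁ (proj₂ (RingEdge.r C)))))
             (trans (cong toℕ eq) (toℕ-fromℕ< (proj₁ (proj₂ (RingEdge.r C'))))))

    cutCode : ∀ {a b} → CutEdge a b → Fin (c₂ + c₂)
    cutCode (inj₁ C) = join c₂ c₂ (inj₁ (position C))
    cutCode (inj₂ C) = join c₂ c₂ (inj₂ (position C))

    cutCode-inj : ∀ {a b a' b'} (X : CutEdge a b) (Y : CutEdge a' b') → cutCode X ≡ cutCode Y → a ≡ a' × b ≡ b'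
    cutCode-inj (inj₁ C) (inj₁ C') eq =
      sameAtLo C C' (position-inj C C' (inj₁-injective (join-injective c₂ c₂ _ _ eq)))
    cutCode-inj (inj₂ C) (inj₂ C') eq =
      let (e1 , e2) = sameAtHi C C' (position-inj C C' (inj₂-injective (join-injective c₂ c₂ _ _ eq))) in e2 , e1
    cutCode-inj (inj₁ C) (inj₂ C') eq with join-injective c₂ c₂ (inj₁ (position C)) (inj₂ (position C')) eq
    ... | ()
    cutCode-inj (inj₂ C) (inj₁ C') eq with join-injective c₂ c₂ (inj₂ (position C)) (inj₁ (position C')) eq
    ... | ()

    arcCut : CutAtMost G InArcV (c₂ + c₂)
    arcCut = record
      { code = λ a b sa nsb adj → cutCode (cutEdge a b sa nsb adj)
      ; code-inj = λ a b a' b' sa nsb adj sa' nsb' adj' →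
          cutCode-inj (cutEdge a b sa nsb adj) (cutEdge a' b' sa' nsb' adj') }

  module _ (I : Immersion (K d) G)
           (inBays : ∀ k → Σ (Fin n) λ i → Σ (Fin (6 + e)) λ p → dec (Immersion.φ I k) ≡ bayV i p) where
    open Branching G (7 + e) I
    open Immersion I using (φ; φ-inj)

    -- bay and position of each branch vertex (abstract to keep the decoding folded)
    abstract
      β : Fin d → Fin n
      β k = proj₁ (inBays k)

      π : Fin d → Fin (6 + e)
      π k = proj₁ (proj₂ (inBays k))

      hβ : ∀ k → dec (φ k) ≡ bayV (β k) (π k)
      hβ k = proj₂ (proj₂ (inBays k))

    βπ-inj : ∀ {k k'} → β k ≡ β k' → π k ≡ π k' → k ≡ k'
    βπ-inj {k} {k'} e1 e2 = φ-inj k k' (dec-inj (trans (hβ k) (trans (cong₂ bayV e1 e2) (sym (hβ k')))))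

    -- an arc holding two branch vertices and missing two others is separated
    -- by d pairs, while its cut has at most 2 ⌈(d-2)/2⌉ < d edges
    arcSeparates : ∀ lo hi (hi<n : hi < n) i₀ i₁ j₀ j₁ → let open Arc lo hi hi<n in
                   InArc (β i₀) → InArc (β i₁) → ¬ InArc (β j₀) → ¬ InArc (β j₁) → i₀ ≢ i₁ → j₀ ≢ j₁ → ⊥
    arcSeparates lo hi hi<n i₀ i₁ j₀ j₁ t₀ t₁ n₀ n₁ i₀≢i₁ j₀≢j₁ =
      ℕP.<-irrefl refl (ℕP.≤-trans (cutBound InArcV? arcCut pairs) (⌈/2⌉-double (6 + e)))
      where
      open Arc lo hi hi<n
      toV : ∀ {k} → InArc (β k) → InArcV (φ k)
      toV {k} t = subst (λ z → InArc (bayOf z)) (sym (hβ k)) t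
      fromV : ∀ {k} → InArcV (φ k) → InArc (β k)
      fromV {k} s = subst (λ z → InArc (bayOf z)) (hβ k) s
      pairs : SeparatedPairs (λ k → InArcV (φ k)) d
      pairs = separatedPairs₂ (λ k → InArcV? (φ k)) i₀ j₀ (toV t₀) (λ s → n₀ (fromV s))
                i₁ j₁ (toV t₁) (λ s → n₁ (fromV s)) i₀≢i₁ j₀≢j₁

    -- d-1 branch vertices in one bay have distinct positions among d-2
    crowded : ∀ b j₀ → (∀ k → k ≢ j₀ → β k ≡ b) → ⊥
    crowded b j₀ inB = ℕP.<-irrefl refl (injective⇒≤ {f = λ k → π (punchIn j₀ k)} πinj)
      where
      πinj : ∀ {k k'} → π (punchIn j₀ k) ≡ π (punchIn j₀ k') → k ≡ k'
      πinj {k} {k'} eq = punchIn-injective j₀ k k'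
        (βπ-inj (trans (inB _ (punchInᵢ≢i j₀ k)) (sym (inB _ (punchInᵢ≢i j₀ k')))) eq)

    -- two branch vertices in one bay b: the bay alone is such an arc unless
    -- all but one branch vertex lie in b, which has only d-2 vertices
    twoInOneBay : ∀ i₀ i₁ → i₀ ≢ i₁ → β i₀ ≡ β i₁ → ⊥
    twoInOneBay i₀ i₁ i₀≢i₁ same with any? (λ k → ¬? (β k ≟F β i₀))
    ... | no none = crowded (β i₀) i₀ (λ k _ → inB k)
      where
      inB : ∀ k → β k ≡ β i₀
      inB k with β k ≟F β i₀
      ... | yes eq = eq
      ... | no ne = ⊥-elim (none (k , ne))
    ... | yes (j₀ , out₀) with any? (λ k → ¬? (k ≟F j₀) ×-dec ¬? (β k ≟F β i₀))
    ...   | yes (j₁ , j₁≢j₀ , out₁) =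
            arcSeparates (toℕ b) (toℕ b) (toℕ<n b) i₀ i₁ j₀ j₁ (inArc refl) (inArc (sym same))
              (λ t → out₀ (fromArc t)) (λ t → out₁ (fromArc t)) i₀≢i₁ (λ eq → j₁≢j₀ (sym eq))
      where
      b = β i₀
      inArc : ∀ {k} → β k ≡ b → Arc.InArc (toℕ b) (toℕ b) (toℕ<n b) (β k)
      inArc eq = ℕP.≤-reflexive (cong toℕ (sym eq)) , ℕP.≤-reflexive (cong toℕ eq)
      fromArc : ∀ {k} → Arc.InArc (toℕ b) (toℕ b) (toℕ<n b) (β k) → β k ≡ b
      fromArc (l , h) = toℕ-injective (ℕP.≤-antisym h l)
    ...   | no none = crowded (β i₀) j₀ inB
      where
      inB : ∀ k → k ≢ j₀ → β k ≡ β i₀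
      inB k k≢j₀ with β k ≟F β i₀
      ... | yes eq = eq
      ... | no ne = ⊥-elim (none (k , k≢j₀ , ne))

    -- in particular no arc holds exactly two branch vertices (d ≥ 4 leaves
    -- two outside)
    arcWithTwo : ∀ lo hi (hi<n : hi < n) i₀ i₁ → let open Arc lo hi hi<n in
                 InArc (β i₀) → InArc (β i₁) → (∀ k → k ≢ i₀ → k ≢ i₁ → ¬ InArc (β k)) → i₀ ≢ i₁ → ⊥
    arcWithTwo lo hi hi<n i₀ i₁ t₀ t₁ only i₀≢i₁ =
      let (j₀ , j₀≢i₀ , j₀≢i₁ , _) = fourth 4≤d i₀ i₁ i₁
          (j₁ , j₁≢i₀ , j₁≢i₁ , j₁≢j₀) = fourth 4≤d i₀ i₁ j₀
      in arcSeparates lo hi hi<n i₀ i₁ j₀ j₁ t₀ t₁ (only j₀ j₀≢i₀ j₀≢i₁) (only j₁ j₁≢i₀ j₁≢i₁)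
           i₀≢i₁ (λ eq → j₁≢j₀ (sym eq))
      where
      4≤d : 4 ≤ d
      4≤d = s≤s (s≤s (s≤s (s≤s z≤n)))

    -- branch vertices in distinct bays: the arc from bay 0 up to the bay of
    -- the second lowest branch vertex holds exactly two of them
    distinctBays : (∀ k k' → β k ≡ β k' → k ≡ k') → ⊥
    distinctBays β-inj =
      arcWithTwo 0 h (toℕ<n (β i₁)) i₀ i₁ (z≤n , i₀≤i₁) (z≤n , ℕP.≤-refl) only (λ eq → i₁≢i₀ (sym eq))
      where
      lowest = argmin (λ _ → ⊤) (λ _ → yes tt) (λ k → toℕ (β k)) (zero , tt)
      i₀ = proj₁ lowest
      second = argmin (λ k → k ≢ i₀) (λ k → ¬? (k ≟F i₀)) (λ k → toℕ (β k)) (punchIn i₀ zero , punchInᵢ≢i i₀ zero)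
      i₁ = proj₁ second
      i₁≢i₀ = proj₁ (proj₂ second)
      i₀≤i₁ = proj₂ (proj₂ lowest) i₁ tt
      h = toℕ (β i₁)
      only : ∀ k → k ≢ i₀ → k ≢ i₁ → ¬ Arc.InArc 0 h (toℕ<n (β i₁)) (β k)
      only k k≢i₀ k≢i₁ (_ , le) = k≢i₁ (β-inj k i₁ (toℕ-injective (ℕP.≤-antisym le (proj₂ (proj₂ second) k k≢i₀))))

    allInBays : ⊥
    allInBays with any? (λ i₀ → any? (λ i₁ → ¬? (i₀ ≟F i₁) ×-dec (β i₀ ≟F β i₁)))
    ... | yes (i₀ , i₁ , ne , eq) = twoInOneBay i₀ i₁ ne eq
    ... | no none = distinctBays β-inj
      where
      β-inj : ∀ k k' → β k ≡ β k' → k ≡ k'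
      β-inj k k' eq with k ≟F k'
      ... | yes e1 = e1
      ... | no ne = ⊥-elim (none (k , k' , ne , eq))

module Degrees (e n m : ℕ) (bay : Fin m → Fin n) (tgt : Fin m → Fin 3 → Fin (6 + e)) where

  open import Defs hiding (sym)
  open FinFacts
  open Pd e
  open Construction e n m bay tgt
  open import Data.Nat using (suc; _*_; _≤_; _<_; _<?_; ⌈_/2⌉)
  import Data.Nat.Properties as ℕP
  open import Data.Fin using (zero; suc; toℕ; fromℕ<; punchIn)
  open import Data.Fin.Properties using (toℕ-injective; toℕ<n; toℕ-fromℕ<; punchInᵢ≢i; injective⇒≤; any?) renaming (_≟_ to _≟F_)
  open import Data.Product using (Σ; ∃; _×_; _,_; proj₁; proj₂)
  open import Data.Sum using (_⊎_; inj₁; inj₂)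
  open import Data.Empty using (⊥; ⊥-elim)
  open import Relation.Nullary using (¬_; yes; no)
  open import Relation.Binary.PropositionalEquality

  copyVertex : Fin m → Fin (suc d) → V
  copyVertex c a = enc (copyV c a)

  copyVertex-inj : ∀ {c a b} → copyVertex c a ≡ copyVertex c b → a ≡ b
  copyVertex-inj {c} {a} {b} eq =
    copyV-injective (trans (sym (dec-enc (copyV c a))) (trans (cong dec eq) (dec-enc (copyV c b))))

  bay≢copy : ∀ {i p c a} → enc (bayV i p) ≢ copyVertex c a
  bay≢copy {i} {p} {c} {a} eq with trans (sym (dec-enc (bayV i p))) (trans (cong dec eq) (dec-enc (copyV c a)))
  ... | ()

  -- mid t sees its bay vertex and the d-2 copy vertices off its deleted path
  midDegree : ∀ c t → DegAtLeast G (copyVertex c (mid t)) (7 + e)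
  midDegree c t = g , ginj , gadj
    where
    F = avoid₃ (mid t) (low t) (high t) (λ eq → mid≢low t t (sym eq)) (λ eq → mid≢high t t (sym eq)) (low≢high t)
    f = proj₁ F
    f-inj = proj₁ (proj₂ F)
    f≢mid = proj₁ (proj₂ (proj₂ F))
    f≢low = proj₁ (proj₂ (proj₂ (proj₂ F)))
    f≢high = proj₂ (proj₂ (proj₂ (proj₂ F)))
    g : Fin (7 + e) → V
    g zero    = enc (bayV (bay c) (tgt c t))
    g (suc i) = copyVertex c (f i)
    ginj : ∀ p q → g p ≡ g q → p ≡ q
    ginj zero    zero    _  = refl
    ginj zero    (suc j) eq = ⊥-elim (bay≢copy eq)
    ginj (suc i) zero    eq = ⊥-elim (bay≢copy (sym eq))
    ginj (suc i) (suc j) eq = cong suc (f-inj (copyVertex-inj eq))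
    notDeleted : ∀ i → ¬ Deleted (toℕ (mid t)) (toℕ (f i))
    notDeleted i del with deletedAtMid t (f i) del
    ... | inj₁ isLow  = f≢low i isLow
    ... | inj₂ isHigh = f≢high i isHigh
    gadj : ∀ p → Adj G (copyVertex c (mid t)) (g p)
    gadj zero    = midAdj c t
    gadj (suc i) = copyAdj c (mid t) (f i) (λ eq → f≢mid i (sym eq)) (notDeleted i)

  soleCandidate : ∀ (a : Fin (suc d)) → ¬ IsMid (toℕ a) →
                  Σ (Fin (suc d)) λ x → x ≢ a × (∀ b → Deleted (toℕ a) (toℕ b) → b ≡ x)
  soleCandidate a nm with partnerOf (toℕ a) <? suc d
  ... | yes lt = fromℕ< lt ,
                 (λ eq → partnerOf≢ (toℕ a) nm (trans (sym (toℕ-fromℕ< lt)) (cong toℕ eq))) ,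
                 (λ b del → toℕ-injective (trans (deletedAtNonMid (toℕ a) (toℕ b) nm del) (sym (toℕ-fromℕ< lt))))
  ... | no ge = punchIn a zero , punchInᵢ≢i a zero ,
                (λ b del → ⊥-elim (ge (subst (_< suc d) (deletedAtNonMid (toℕ a) (toℕ b) nm del) (toℕ<n b))))

  -- any other vertex sees all copy vertices but itself and its partner
  nonMidDegree : ∀ c a → ¬ IsMid (toℕ a) → DegAtLeast G (copyVertex c a) (7 + e)
  nonMidDegree c a nm = g , (λ p q eq → f-inj (copyVertex-inj eq)) , gadj
    where
    X = soleCandidate a nm
    x = proj₁ X
    onlyX = proj₂ (proj₂ X)
    F = avoid₂ a x (proj₁ (proj₂ X))
    f = proj₁ F
    f-inj = proj₁ (proj₂ F)
    f≢a = proj₁ (proj₂ (proj₂ F))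
    f≢x = proj₁ (proj₂ (proj₂ (proj₂ F)))
    g : Fin (7 + e) → V
    g i = copyVertex c (f i)
    gadj : ∀ p → Adj G (copyVertex c a) (g p)
    gadj i = copyAdj c a (f i) (λ eq → f≢a i (sym eq)) (λ del → f≢x i (onlyX (f i) del))

  copyDegree : ∀ c a → DegAtLeast G (copyVertex c a) (7 + e)
  copyDegree c a with any? (λ t → toℕ a ℕP.≟ 3 * toℕ t + 1)
  ... | yes (t , ea) = subst (λ z → DegAtLeast G (copyVertex c z) (7 + e)) (sym (toℕ≡mid t ea)) (midDegree c t)
  ... | no nm = nonMidDegree c a nm

  -- vertex 0 of a copy sees exactly the copy vertices other than 0 and 1
  copyZeroDegree : ∀ c → HasDegree G (copyVertex c zero) (7 + e)
  copyZeroDegree c = g , (λ p q eq → f-inj (copyVertex-inj eq)) , gadj , gsurj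
    where
    F = avoid₂ {7 + e} zero (suc zero) (λ ())
    f = proj₁ F
    f-inj = proj₁ (proj₂ F)
    f≢0 = proj₁ (proj₂ (proj₂ F))
    f≢1 = proj₁ (proj₂ (proj₂ (proj₂ F)))
    f-onto = proj₂ (proj₂ (proj₂ (proj₂ F)))
    g : Fin (7 + e) → V
    g i = copyVertex c (f i)
    zeroNotMid : ¬ IsMid 0
    zeroNotMid (t , eq) = ℕP.0≢1+n (trans eq (ℕP.+-comm (3 * toℕ t) 1))
    deleted01 : Deleted 0 1
    deleted01 = inj₂ (inj₁ (zero , refl , inj₁ refl))
    gadj : ∀ i → Adj G (copyVertex c zero) (g i)
    gadj i = copyAdj c zero (f i) (λ eq → f≢0 i (sym eq))
               (λ del → f≢1 i (toℕ-injective (deletedAtNonMid 0 (toℕ (f i)) zeroNotMid del)))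
    open Neighbours (copyVertex c zero) c zero (dec-enc (copyV c zero))
    gsurj : ∀ u → Adj G (copyVertex c zero) u → ∃ λ i → g i ≡ u
    gsurj u adj with nbLabel u adj
    ... | idx , inj₂ (t , _ , zm , _) = ⊥-elim (zeroNotMid (t , trans (cong toℕ zm) (toℕ-mid t)))
    ... | idx , inj₁ (du , nd , nab) =
          let (i , fi) = f-onto idx (λ eq → nab (sym eq)) (λ eq → nd (subst (λ z → Deleted 0 (toℕ z)) (sym eq) deleted01))
          in i , trans (cong (copyVertex c) fi) (trans (cong enc (sym du)) (enc-dec u))

  -- a^i_1 is joined to a^{i+1}_j only if j = d-2, which exceeds ⌈(d-2)/2⌉
  notRingTarget : ∀ {q : Fin (6 + e)} → label q ≤ ⌈ 6 + e /2⌉ → label q + label {6 + e} zero ≡ 7 + e → ⊥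
  notRingTarget {q} le eq = ℕP.<⇒≱ (ℕP.⌈n/2⌉<n (4 + e)) (subst (_≤ ⌈ 6 + e /2⌉) lq le)
    where
    lq : label q ≡ 6 + e
    lq = ℕP.+-cancelʳ-≡ 1 (label q) (6 + e) (trans eq (ℕP.+-comm 1 (6 + e)))

  -- without copies, a^i_1 has only d-3 bay mates and one ring neighbour
  bayDeficient : (Fin m → ⊥) → (i₀ : Fin n) → ¬ DegAtLeast G (enc (bayV i₀ zero)) (7 + e)
  bayDeficient noCopies i₀ (g , ginj , gadj) = ℕP.<-irrefl refl (injective⇒≤ {f = λ p → proj₁ (slot p)} slot-inj)
    where
    -- neighbours are indexed by Fin (d-2): bay mates by their position (≠ 0),
    -- the ring neighbour by 0
    Slot : V → Fin (6 + e) → Set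
    Slot u idx = (dec u ≡ bayV i₀ idx × idx ≢ zero)
               ⊎ (idx ≡ zero × Σ (Fin n) λ i → Σ (Fin (6 + e)) λ q → dec u ≡ bayV i q × Ring d n i₀ zero i q)
    slot : ∀ p → Σ (Fin (6 + e)) (Slot (g p))
    slot p with decoded (g p)
    ... | isCopy c _ _ = ⊥-elim (noCopies c)
    ... | isBay i q eu with i ≟F i₀
    ...   | yes refl = q , inj₁ (eu , λ { refl → proj₁ (gadj p) (dec-inj (trans (dec-enc (bayV i₀ zero)) (sym eu))) })
    ...   | no ne with adjView (gadj p) (dec-enc (bayV i₀ zero)) eu
    ...     | inj₁ (inj₁ e1) = ⊥-elim (ne (sym e1))
    ...     | inj₂ (inj₁ e1) = ⊥-elim (ne e1)
    ...     | inj₁ (inj₂ r) = zero , inj₂ (refl , i , q , eu , r)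
    ...     | inj₂ (inj₂ (_ , le , eq)) = ⊥-elim (notRingTarget le eq)
    sameSlot : ∀ {p p'} (X : Σ (Fin (6 + e)) (Slot (g p))) (Y : Σ (Fin (6 + e)) (Slot (g p'))) →
               proj₁ X ≡ proj₁ Y → g p ≡ g p'
    sameSlot (idx , inj₁ (e1 , _)) (.idx , inj₁ (e2 , _)) refl = dec-inj (trans e1 (sym e2))
    sameSlot (idx , inj₁ (_ , nz)) (.idx , inj₂ (z , _)) refl = ⊥-elim (nz z)
    sameSlot (idx , inj₂ (z , _)) (.idx , inj₁ (_ , nz)) refl = ⊥-elim (nz z)
    sameSlot (idx , inj₂ (_ , i , q , e1 , r1)) (.idx , inj₂ (_ , i' , q' , e2 , r2)) refl
      with predUnique (proj₁ r1) (proj₁ r2) | ringPartner r1 r2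
    ... | refl | refl = dec-inj (trans e1 (sym e2))
    slot-inj : ∀ {p p'} → proj₁ (slot p) ≡ proj₁ (slot p') → p ≡ p'
    slot-inj {p} {p'} eq = ginj p p' (sameSlot (slot p) (slot p') eq)

module Main (e n m : ℕ) (bay : Fin m → Fin n) (tgt : Fin m → Fin 3 → Fin (6 + e)) where

  open import Defs hiding (sym)
  open Construction e n m bay tgt
  open Degrees e n m bay tgt
  open CopyCase e n m bay tgt
  open BayCase e n m bay tgt
  open import Data.Nat using (zero; suc)
  open import Data.Fin using (zero)
  open import Data.Fin.Properties using (any?; all?; ¬∀⟶∃¬)
  open import Data.Product using (Σ; ∃; _,_)
  open import Data.Empty using (⊥-elim)
  open import Data.Unit using (tt)
  open import Relation.Nullary using (¬_; Dec; yes; no)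
  open import Relation.Binary.PropositionalEquality

  inSomeCopy? : ∀ v → Dec (Σ (Fin m) λ c → InC c v)
  inSomeCopy? v with decoded v
  ... | isCopy c _ ev = yes (c , subst (IsCopy c) (sym ev) refl)
  ... | isBay _ _ ev  = no λ { (c , ic) → subst (IsCopy c) ev ic }

  noImmersion : ¬ Immersion (K d) G
  noImmersion I with any? (λ k → inSomeCopy? (Immersion.φ I k))
  ... | yes (k , c , ic) with all? (λ k' → InC? c (Immersion.φ I k'))
  ...   | yes inside = Inside.allInside I c inside
  ...   | no notAll = let (j , nj) = ¬∀⟶∃¬ d _ (λ k' → InC? c (Immersion.φ I k')) notAll in
                      splitCopy I c k j ic nj
  noImmersion I | no none = allInBays I inBay
    where
    inBay : ∀ k → Σ (Fin n) λ i → Σ (Fin (6 + e)) λ p → dec (Immersion.φ I k) ≡ bayV i p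
    inBay k with decoded (Immersion.φ I k)
    ... | isBay i p ev  = i , p , ev
    ... | isCopy c _ ev = ⊥-elim (none (k , c , subst (IsCopy c) (sym ev) refl))

  minDegree : Fin n → (∀ v → IsBay (dec v) → DegAtLeast G v (7 + e)) → MinDegree G (7 + e)
  minDegree i₀ bayDeg = atLeast , exactly m refl
    where
    atLeast : ∀ v → DegAtLeast G v (7 + e)
    atLeast v with decoded v
    ... | isBay i p ev  = bayDeg v (subst IsBay (sym ev) tt)
    ... | isCopy c a ev = subst (λ z → DegAtLeast G z (7 + e)) (trans (cong enc (sym ev)) (enc-dec v)) (copyDegree c a)
    exactly : ∀ m' → m' ≡ m → ∃ λ v → HasDegree G v (7 + e)
    exactly (suc _) refl = copyVertex zero zero , copyZeroDegree zero
    exactly zero    refl = ⊥-elim (bayDeficient (λ ()) i₀ (bayDeg v₀ (subst IsBay (sym (dec-enc (bayV i₀ zero))) tt)))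
      where v₀ = enc (bayV i₀ zero)

open Main using (minDegree; noImmersion)

-- write d = 8 + e (so d-2 = 6 + e and d-1 = 7 + e) and use bay 0 (n ≥ 1)

theorem4p12 : (d n m : ℕ) → 8 ≤ d → 1 ≤ n →
    (bay : Fin m → Fin n) (tgt : Fin m → Fin 3 → Fin (d ∸ 2)) →
    (∀ v → IsBay (decode d n m v) → DegAtLeast (Gnd d n m bay tgt) v (d ∸ 1)) →
    MinDegree (Gnd d n m bay tgt) (d ∸ 1) × ¬ Immersion (K d) (Gnd d n m bay tgt)
theorem4p12 _ (suc _) m (s≤s (s≤s (s≤s (s≤s (s≤s (s≤s (s≤s (s≤s (z≤n {n = e}))))))))) (s≤s z≤n) bay tgt bayDeg =
  minDegree e _ m bay tgt zero bayDeg , noImmersion e _ m bay tgt
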